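{- Let $n\ge1$ and $q\in\mathbf Q_{>0}$. The set $\Sigma_{n,q}=\{\sigma_{J,K}: J,K\subseteq[n],\ J\cap K=\emptyset\}$ is a simplicial fan in $\mathbf R^n$; equivalently, the associated toric variety $X_{\Sigma_{n,q}}$ is $\mathbf Q$-factorial.
   Context: Let $A=A(n,q)$ be the $n\times n$ tridiagonal matrix with $A_{ii}=q+1$, $A_{i,i+1}=-1$, $A_{i+1,i}=-q$, other entries $0$; let $\alpha_1,\dots,\alpha_n$ be its columns and $e_1,\dots,e_n$ the standard basis of $\mathbf Z^n$. For disjoint $J,K\subseteq[n]$, $\sigma_{J,K}=\mathrm{cone}(\{e_i\}_{i\in J}\cup\{ -\alpha_k\}_{k\in K})$, with $\sigma_{\emptyset,\emptyset}=\{0\}$.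
   Formalization: The cones are taken as their sets of points in ℚ^n rather than ℝ^n, face functionals u are rational, and linear independence of generators is over the rationals. -}

module Defs where

open import Data.Nat using (ℕ; zero; suc)
import Data.Nat as ℕ
open import Data.Fin using (Fin; toℕ)
import Data.Fin as F
open import Data.Fin.Subset using (Subset; _∈_)
open import Data.Fin.Subset.Properties using (_∈?_)
open import Data.List using (List; length; lookup; filter; map; _++_; allFin)
open import Data.Rational using (ℚ; 0ℚ; 1ℚ; _+_; _*_; -_; _≤_)
open import Data.Product using (Σ; ∃; _×_; _,_)
open import Data.Bool using (if_then_else_)
open import Data.Empty using (⊥)
open import Relation.Nullary.Decidable using (⌊_⌋)
open import Relation.Binary.PropositionalEquality using (_≡_)
open import Function.Bundles using (_⇔_)

-- Vectors in ℚ^n (rational points of ℝ^n)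
Vec : ℕ → Set
Vec n = Fin n → ℚ

sumFin : ∀ {n} → (Fin n → ℚ) → ℚ
sumFin {zero} f = 0ℚ
sumFin {suc n} f = f F.zero + sumFin (λ i → f (F.suc i))

dot : ∀ {n} → Vec n → Vec n → ℚ
dot u x = sumFin (λ i → u i * x i)

zeroV : ∀ {n} → Vec n
zeroV _ = 0ℚ

negV : ∀ {n} → Vec n → Vec n
negV x i = - x i

_≗V_ : ∀ {n} → Vec n → Vec n → Set
x ≗V y = ∀ i → x i ≡ y i

linComb : ∀ {n} (L : List (Vec n)) → (Fin (length L) → ℚ) → Vec n
linComb L c i = sumFin (λ j → c j * lookup L j i)

Cone : ℕ → Set₁
Cone n = Vec n → Set

cone : ∀ {n} → List (Vec n) → Cone n
cone L x = Σ (Fin (length L) → ℚ) λ c → (∀ j → 0ℚ ≤ c j) × (x ≗V linComb L c)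

LinIndep : ∀ {n} → List (Vec n) → Set
LinIndep L = ∀ (c : Fin (length L) → ℚ) → linComb L c ≗V zeroV → ∀ j → c j ≡ 0ℚ

_≐_ : ∀ {n} → Cone n → Cone n → Set
S ≐ T = ∀ x → S x ⇔ T x

IsFace : ∀ {n} → Cone n → Cone n → Set
IsFace {n} σ τ = Σ (Vec n) λ u →
  (∀ x → σ x → 0ℚ ≤ dot u x) × (τ ≐ (λ x → σ x × dot u x ≡ 0ℚ))

StronglyConvex : ∀ {n} → Cone n → Set
StronglyConvex σ = ∀ x → σ x → σ (negV x) → x ≗V zeroV

RationalPolyhedral : ∀ {n} → Cone n → Set
RationalPolyhedral {n} σ = Σ (List (Vec n)) λ L → σ ≐ cone L

Simplicial : ∀ {n} → Cone n → Set
Simplicial {n} σ = Σ (List (Vec n)) λ L → LinIndep L × (σ ≐ cone L)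

record IsFan {n} (I : Set) (C : I → Cone n) : Set₁ where
  field
    polyhedral      : ∀ i → RationalPolyhedral (C i)
    stronglyConvex  : ∀ i → StronglyConvex (C i)
    faceClosed      : ∀ i (τ : Cone n) → IsFace (C i) τ → Σ I λ j → τ ≐ C j
    intersectFace   : ∀ i j → IsFace (C i) (λ x → C i x × C j x)
                             × IsFace (C j) (λ x → C i x × C j x)

record IsSimplicialFan {n} (I : Set) (C : I → Cone n) : Set₁ where
  field
    isFan      : IsFan I C
    simplicial : ∀ i → Simplicial (C i)

e : ∀ {n} → Fin n → Vec n
e k i = if ⌊ toℕ i ℕ.≟ toℕ k ⌋ then 1ℚ else 0ℚ

-- α_k = k-th column of A(n,q): A_ii = q+1, A_{i,i+1} = -1, A_{i+1,i} = -q
α : ∀ {n} → ℚ → Fin n → Vec n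
α q k i =
  if ⌊ toℕ i ℕ.≟ toℕ k ⌋ then q + 1ℚ
  else if ⌊ suc (toℕ i) ℕ.≟ toℕ k ⌋ then - 1ℚ
  else if ⌊ toℕ i ℕ.≟ suc (toℕ k) ⌋ then - q
  else 0ℚ

Disjoint : ∀ {n} → Subset n → Subset n → Set
Disjoint J K = ∀ i → i ∈ J → i ∈ K → ⊥

elems : ∀ {n} → Subset n → List (Fin n)
elems J = filter (_∈? J) (allFin _)

gens : ∀ {n} → ℚ → Subset n → Subset n → List (Vec n)
gens q J K = map e (elems J) ++ map (λ k → negV (α q k)) (elems K)

σ : ∀ {n} → ℚ → Subset n → Subset n → Cone n
σ q J K = cone (gens q J K)

Idx : ℕ → Set
Idx n = Σ (Subset n × Subset n) λ { (J , K) → Disjoint J K }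

Σnq : (n : ℕ) → ℚ → Idx n → Cone n
Σnq n q ((J , K) , _) = σ q J K

{-# OPTIONS --safe #-}
-- Every point of σ_{J,K} is x = w − A z with w ≥ 0 supported on J and z ≥ 0 supported on K,
-- where A z = Σ_k z_k α_k.  The matrix A reverses no signs: with D = diag(q⁻ⁱ) one has
-- zᵀ D A z = Σ_{m=0}^{n} q⁻ᵐ (z_m − z_{m+1})² (z_0 = z_{n+1} = 0), so z_i (A z)_i ≤ 0 for
-- all i forces z = 0.  If w − A z = w′ − A z′ are two such representations (for disjoint
-- pairs of supports), then (z − z′)_i (A (z − z′))_i = −(z_i w′_i + z′_i w_i) ≤ 0, so
-- representations are unique; hence the generators are linearly independent and
-- σ_{J,K} ∩ σ_{J′,K′} = σ_{J∩J′,K∩K′}.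
-- Faces are cut out by functionals u that are ≥ 0 on the generators: σ_{J,K} ∩ u^⊥ is the
-- cone on the generators that u kills.  Conversely, u can be given arbitrary values on
-- the basis {e_i}_{i∉K} ∪ {−α_k}_{k∈K}, because that linear system is tridiagonal and
-- forward elimination only meets pivots ≥ 1; so every σ_{J∩J₀,K∩K₀} is a face of σ_{J,K},
-- and the face σ_{∅,∅} = {0} gives strong convexity.
module Submission where

open import Defs
open import Data.Nat using (ℕ)
import Data.Nat as ℕ
open import Data.Rational using (ℚ; 0ℚ; _<_)

open import Algebra.Bundles using (CommutativeRing)
open import Data.Bool using (Bool; true; false; if_then_else_)
open import Data.Empty using (⊥-elim)
open import Data.Fin using (Fin; toℕ)
import Data.Fin as F
import Data.Fin.Properties as FP
open import Data.Fin.Subset using (Subset; _∈_; _∉_; _∩_; ⊥)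
open import Data.Fin.Subset.Properties using (_∈?_; x∈p∩q⁺; x∈p∩q⁻; p∩q⊆p; p∩q⊆q; ∉⊥)
open import Data.List using (List; []; _∷_; length; map; _++_; allFin)
open import Data.List.Membership.Propositional using () renaming (_∈_ to _∈ₗ_)
open import Data.List.Membership.Propositional.Properties using (∈-filter⁺; ∈-filter⁻; ∈-allFin)
open import Data.List.Relation.Unary.AllPairs using (_∷_)
open import Data.List.Relation.Unary.Any using (here; there)
open import Data.List.Relation.Unary.Unique.Propositional using (Unique)
open import Data.List.Relation.Unary.Unique.Propositional.Properties
  using (Unique[x∷xs]⇒x∉xs; filter⁺; allFin⁺)
open import Data.Nat using (zero; suc; _∸_; _≡ᵇ_)
import Data.Nat.Properties as ℕP
open import Data.Product using (Σ; _×_; _,_; proj₁; proj₂; swap)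
open import Data.Rational using (1ℚ; _+_; _*_; -_; _-_; _≤_; 1/_; NonZero)
import Data.Rational as Q
import Data.Rational.Properties as QP
open import Data.Rational.Solver using (module +-*-Solver)
open +-*-Solver using (solve; _:+_; _:*_; _:-_; :-_; _:=_; con)
open import Data.Sum using (_⊎_; inj₁; inj₂)
open import Data.Unit using (tt)
open import Data.Vec.Base using ([]; _∷_; here; there)
open import Data.Vec.Functional using (updateAt)
open import Data.Vec.Functional.Properties using (updateAt-updates; updateAt-minimal)
open import Function using (_∘_; id)
open import Function.Bundles using (_⇔_; mk⇔; Equivalence)
open import Relation.Binary.PropositionalEquality
open import Relation.Nullary using (¬_; Dec; yes; no)
open import Relation.Nullary.Decidable using (⌊_⌋; does; dec-true; dec-false)

open import Algebra.Properties.Group QP.+-0-group using ()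
  renaming (x∙y⁻¹≈ε⇒x≈y to p-q≡0⇒p≡q; ⁻¹-involutive to neg-involutive)
open import Algebra.Properties.Semiring.Sum (CommutativeRing.semiring QP.+-*-commutativeRing)
  using (sum; sum-cong-≗; ∑-distrib-+; ∑-comm; *-distribˡ-sum; sum-replicate-zero)

*-nonNeg : ∀ {p q} → 0ℚ ≤ p → 0ℚ ≤ q → 0ℚ ≤ p * q
*-nonNeg {p} {q} 0≤p 0≤q =
  QP.nonNegative⁻¹ _ {{QP.nonNeg*nonNeg⇒nonNeg p {{Q.nonNegative 0≤p}} q {{Q.nonNegative 0≤q}}}}

+-nonNeg : ∀ {p q} → 0ℚ ≤ p → 0ℚ ≤ q → 0ℚ ≤ p + q
+-nonNeg = QP.+-mono-≤

+-nonNeg-≡0ˡ : ∀ {p q} → 0ℚ ≤ p → 0ℚ ≤ q → p + q ≡ 0ℚ → p ≡ 0ℚ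
+-nonNeg-≡0ˡ {p} {q} 0≤p 0≤q p+q≡0 = QP.≤-antisym p≤0 0≤p
  where
  p≤0 : p ≤ 0ℚ
  p≤0 = subst₂ _≤_ (QP.+-identityʳ p) p+q≡0 (QP.+-monoʳ-≤ p 0≤q)

+-nonNeg-≡0ʳ : ∀ {p q} → 0ℚ ≤ p → 0ℚ ≤ q → p + q ≡ 0ℚ → q ≡ 0ℚ
+-nonNeg-≡0ʳ {p} {q} 0≤p 0≤q p+q≡0 = +-nonNeg-≡0ˡ 0≤q 0≤p (trans (QP.+-comm q p) p+q≡0)

*-nonNeg-nonPos : ∀ {p q} → 0ℚ ≤ p → q ≤ 0ℚ → p * q ≤ 0ℚ
*-nonNeg-nonPos {p} {q} 0≤p q≤0 =
  subst (p * q ≤_) (QP.*-zeroʳ p) (QP.*-monoˡ-≤-nonNeg p {{Q.nonNegative 0≤p}} q≤0)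

square-nonNeg : ∀ p → 0ℚ ≤ p * p
square-nonNeg p with QP.≤-total 0ℚ p
... | inj₁ 0≤p = *-nonNeg 0≤p 0≤p
... | inj₂ p≤0 = subst (0ℚ ≤_) (solve 1 (λ p → (:- p) :* (:- p) := p :* p) refl p)
                   (*-nonNeg (QP.neg-antimono-≤ p≤0) (QP.neg-antimono-≤ p≤0))

≢0*≡0⇒≡0 : ∀ {p q} → p ≢ 0ℚ → p * q ≡ 0ℚ → q ≡ 0ℚ
≢0*≡0⇒≡0 {p} {q} p≢0 pq≡0 = begin
  q                ≡⟨ solve 1 (λ q → q := q :* con 1ℚ) refl q ⟩
  q * 1ℚ           ≡⟨ cong (q *_) (sym (QP.*-inverseʳ p)) ⟩
  q * (p * 1/ p)   ≡⟨ solve 3 (λ q p r → q :* (p :* r) := (p :* q) :* r) refl q p (1/ p) ⟩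
  (p * q) * 1/ p   ≡⟨ cong (_* 1/ p) pq≡0 ⟩
  0ℚ * 1/ p        ≡⟨ QP.*-zeroˡ (1/ p) ⟩
  0ℚ               ∎
  where
  open ≡-Reasoning
  instance
    p-nonZero : NonZero p
    p-nonZero = Q.≢-nonZero p≢0

pos⇒≢0 : ∀ {p} → 0ℚ < p → p ≢ 0ℚ
pos⇒≢0 0<p = ≢-sym (QP.<⇒≢ 0<p)

square≡0⇒≡0 : ∀ p → p * p ≡ 0ℚ → p ≡ 0ℚ
square≡0⇒≡0 p p²≡0 with p QP.≟ 0ℚ
... | yes p≡0 = p≡0
... | no p≢0 = ≢0*≡0⇒≡0 p≢0 p²≡0

≡0⊎≡0⇒*≡0 : ∀ {p q} → p ≡ 0ℚ ⊎ q ≡ 0ℚ → p * q ≡ 0ℚ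
≡0⊎≡0⇒*≡0 {q = q} (inj₁ refl) = QP.*-zeroˡ q
≡0⊎≡0⇒*≡0 {p = p} (inj₂ refl) = QP.*-zeroʳ p

sumFin≡sum : ∀ {n} (f : Fin n → ℚ) → sumFin f ≡ sum f
sumFin≡sum {zero} f = refl
sumFin≡sum {suc n} f = cong (f F.zero +_) (sumFin≡sum (f ∘ F.suc))

sum-≡0 : ∀ {n} {f : Fin n → ℚ} → (∀ i → f i ≡ 0ℚ) → sum f ≡ 0ℚ
sum-≡0 {n} f≡0 = trans (sum-cong-≗ f≡0) (sum-replicate-zero n)

sum-nonNeg : ∀ {n} {f : Fin n → ℚ} → (∀ i → 0ℚ ≤ f i) → 0ℚ ≤ sum f
sum-nonNeg {zero} f≥0 = QP.≤-refl
sum-nonNeg {suc n} f≥0 = +-nonNeg (f≥0 F.zero) (sum-nonNeg (f≥0 ∘ F.suc))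

sum-nonNeg-≡0 : ∀ {n} {f : Fin n → ℚ} → (∀ i → 0ℚ ≤ f i) → sum f ≡ 0ℚ → ∀ i → f i ≡ 0ℚ
sum-nonNeg-≡0 {suc n} f≥0 Σ≡0 F.zero = +-nonNeg-≡0ˡ (f≥0 F.zero) (sum-nonNeg (f≥0 ∘ F.suc)) Σ≡0
sum-nonNeg-≡0 {suc n} f≥0 Σ≡0 (F.suc i) =
  sum-nonNeg-≡0 (f≥0 ∘ F.suc) (+-nonNeg-≡0ʳ (f≥0 F.zero) (sum-nonNeg (f≥0 ∘ F.suc)) Σ≡0) i

sum-neg : ∀ {n} (f : Fin n → ℚ) → sum (λ i → - f i) ≡ - sum f
sum-neg f = begin
  sum (λ i → - f i)          ≡⟨ sum-cong-≗ (λ i → solve 1 (λ x → :- x := con (- 1ℚ) :* x) refl (f i)) ⟩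
  sum (λ i → - 1ℚ * f i)     ≡⟨ sym (*-distribˡ-sum (- 1ℚ) f) ⟩
  - 1ℚ * sum f               ≡⟨ solve 1 (λ x → con (- 1ℚ) :* x := :- x) refl (sum f) ⟩
  - sum f                    ∎
  where open ≡-Reasoning

sum-*-combination : ∀ {n} (f X Y Z : Fin n → ℚ) a b c →
  sum (λ i → f i * (a * X i + b * Y i + c * Z i))
    ≡ a * sum (λ i → f i * X i) + b * sum (λ i → f i * Y i) + c * sum (λ i → f i * Z i)
sum-*-combination f X Y Z a b c = begin
  sum (λ i → f i * (a * X i + b * Y i + c * Z i))
    ≡⟨ sum-cong-≗ (λ i → solve 7 (λ f x y z a b c → f :* (a :* x :+ b :* y :+ c :* z)
                                   := a :* (f :* x) :+ b :* (f :* y) :+ c :* (f :* z))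
                                 refl (f i) (X i) (Y i) (Z i) a b c) ⟩
  sum (λ i → a * (f i * X i) + b * (f i * Y i) + c * (f i * Z i))
    ≡⟨ ∑-distrib-+ (λ i → a * (f i * X i) + b * (f i * Y i)) (λ i → c * (f i * Z i)) ⟩
  sum (λ i → a * (f i * X i) + b * (f i * Y i)) + sum (λ i → c * (f i * Z i))
    ≡⟨ cong (_+ sum (λ i → c * (f i * Z i))) (∑-distrib-+ (λ i → a * (f i * X i)) (λ i → b * (f i * Y i))) ⟩
  sum (λ i → a * (f i * X i)) + sum (λ i → b * (f i * Y i)) + sum (λ i → c * (f i * Z i))
    ≡⟨ sym (cong₂ _+_ (cong₂ _+_ (*-distribˡ-sum a (λ i → f i * X i)) (*-distribˡ-sum b (λ i → f i * Y i)))
                          (*-distribˡ-sum c (λ i → f i * Z i))) ⟩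
  a * sum (λ i → f i * X i) + b * sum (λ i → f i * Y i) + c * sum (λ i → f i * Z i)
    ∎
  where open ≡-Reasoning

sumN : ℕ → (ℕ → ℚ) → ℚ
sumN zero f = 0ℚ
sumN (suc N) f = sumN N f + f N

sumN-nonNeg : ∀ N {f : ℕ → ℚ} → (∀ m → 0ℚ ≤ f m) → 0ℚ ≤ sumN N f
sumN-nonNeg zero f≥0 = QP.≤-refl
sumN-nonNeg (suc N) f≥0 = +-nonNeg (sumN-nonNeg N f≥0) (f≥0 N)

sumN-nonPos : ∀ N {f : ℕ → ℚ} → (∀ m → m ℕ.< N → f m ≤ 0ℚ) → sumN N f ≤ 0ℚ
sumN-nonPos zero f≤0 = QP.≤-refl
sumN-nonPos (suc N) f≤0 = QP.+-mono-≤ (sumN-nonPos N (λ m m<N → f≤0 m (ℕP.m<n⇒m<1+n m<N))) (f≤0 N ℕP.≤-refl)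

sumN-nonNeg-≡0 : ∀ N {f : ℕ → ℚ} → (∀ m → 0ℚ ≤ f m) → sumN N f ≡ 0ℚ → ∀ m → m ℕ.< N → f m ≡ 0ℚ
sumN-nonNeg-≡0 (suc N) f≥0 Σ≡0 m m<1+N with ℕP.m≤n⇒m<n∨m≡n (ℕ.s≤s⁻¹ m<1+N)
... | inj₁ m<N = sumN-nonNeg-≡0 N f≥0 (+-nonNeg-≡0ˡ (sumN-nonNeg N f≥0) (f≥0 N) Σ≡0) m m<N
... | inj₂ refl = +-nonNeg-≡0ʳ (sumN-nonNeg N f≥0) (f≥0 N) Σ≡0

⌊≟⌋≡≡ᵇ : ∀ m n → ⌊ m ℕ.≟ n ⌋ ≡ (m ≡ᵇ n)
⌊≟⌋≡≡ᵇ m n with m ℕ.≟ n | m ≡ᵇ n | ℕP.≡ᵇ⇒≡ m n | ℕP.≡⇒≡ᵇ m n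
... | yes _ | true | _ | _ = refl
... | yes m≡n | false | _ | m≡n⇒⊥ = ⊥-elim (m≡n⇒⊥ m≡n)
... | no _ | false | _ | _ = refl
... | no m≢n | true | ≡ᵇ⇒m≡n | _ = ⊥-elim (m≢n (≡ᵇ⇒m≡n tt))

-- Unlike ⌊ m ℕ.≟ n ⌋, which e and α are built from, m ≡ᵇ n reduces on suc m and suc n.
δ : ℕ → ℕ → ℚ
δ m n = if m ≡ᵇ n then 1ℚ else 0ℚ

δ-sym : ∀ m n → δ m n ≡ δ n m
δ-sym zero zero = refl
δ-sym zero (suc n) = refl
δ-sym (suc m) zero = refl
δ-sym (suc m) (suc n) = δ-sym m n

δ-refl : ∀ m → δ m m ≡ 1ℚ
δ-refl zero = refl
δ-refl (suc m) = δ-refl m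

δ-≢ : ∀ {m n} → m ≢ n → δ m n ≡ 0ℚ
δ-≢ {zero} {zero} 0≢0 = ⊥-elim (0≢0 refl)
δ-≢ {zero} {suc n} _ = refl
δ-≢ {suc m} {zero} _ = refl
δ-≢ {suc m} {suc n} m+1≢n+1 = δ-≢ (m+1≢n+1 ∘ cong suc)

δ-nonNeg : ∀ m n → 0ℚ ≤ δ m n
δ-nonNeg zero zero = QP.<⇒≤ (QP.positive⁻¹ 1ℚ)
δ-nonNeg zero (suc n) = QP.≤-refl
δ-nonNeg (suc m) zero = QP.≤-refl
δ-nonNeg (suc m) (suc n) = δ-nonNeg m n

e≡δ : ∀ {n} (k i : Fin n) → e k i ≡ δ (toℕ i) (toℕ k)
e≡δ k i = cong (if_then 1ℚ else 0ℚ) (⌊≟⌋≡≡ᵇ (toℕ i) (toℕ k))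

e-diagonal : ∀ {n} (k : Fin n) → e k k ≡ 1ℚ
e-diagonal k = trans (e≡δ k k) (δ-refl (toℕ k))

e-off-diagonal : ∀ {n} {k l : Fin n} → l ≢ k → e k l ≡ 0ℚ
e-off-diagonal {k = k} {l} l≢k = trans (e≡δ k l) (δ-≢ (l≢k ∘ FP.toℕ-injective))

e-nonNeg : ∀ {n} (k l : Fin n) → 0ℚ ≤ e k l
e-nonNeg k l = subst (0ℚ ≤_) (sym (e≡δ k l)) (δ-nonNeg (toℕ l) (toℕ k))

-- f read as a sequence indexed from 1, with the default d at 0 and beyond n; on zero-padded
-- sequences A and Aᵀ act as three-term recurrences.
padWith : ∀ {A : Set} {n} → A → (Fin n → A) → ℕ → A
padWith {n = zero} d f m = d
padWith {n = suc n} d f zero = d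
padWith {n = suc n} d f (suc zero) = f F.zero
padWith {n = suc n} d f (suc (suc m)) = padWith d (f ∘ F.suc) (suc m)

pad : ∀ {n} → Vec n → ℕ → ℚ
pad = padWith 0ℚ

padWith-zero : ∀ {A : Set} {n} (d : A) (f : Fin n → A) → padWith d f zero ≡ d
padWith-zero {n = zero} d f = refl
padWith-zero {n = suc n} d f = refl

padWith-toℕ : ∀ {A : Set} {n} (d : A) (f : Fin n → A) (i : Fin n) → padWith d f (suc (toℕ i)) ≡ f i
padWith-toℕ d f F.zero = refl
padWith-toℕ d f (F.suc i) = padWith-toℕ d (f ∘ F.suc) i

padWith-suc-n : ∀ {A : Set} {n} (d : A) (f : Fin n → A) → padWith d f (suc n) ≡ d
padWith-suc-n {n = zero} d f = refl
padWith-suc-n {n = suc n} d f = padWith-suc-n d (f ∘ F.suc)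

sum-δ : ∀ {n} (f : Fin n → ℚ) m → sum (λ l → f l * δ (toℕ l) m) ≡ pad f (suc m)
sum-δ {zero} f m = refl
sum-δ {suc n} f zero =
  trans (cong₂ _+_ (QP.*-identityʳ (f F.zero)) (sum-≡0 (λ l → QP.*-zeroʳ (f (F.suc l)))))
        (QP.+-identityʳ (f F.zero))
sum-δ {suc n} f (suc m) =
  trans (cong₂ _+_ (QP.*-zeroʳ (f F.zero)) (sum-δ (f ∘ F.suc) m))
        (QP.+-identityˡ (pad f (suc (suc m))))

sum-δ-suc : ∀ {n} (f : Fin n → ℚ) m → sum (λ l → f l * δ (suc (toℕ l)) m) ≡ pad f m
sum-δ-suc f zero = trans (sum-≡0 (λ l → QP.*-zeroʳ (f l))) (sym (padWith-zero 0ℚ f))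
sum-δ-suc f (suc m) = sum-δ f m

sum-δʳ : ∀ {n} (f : Fin n → ℚ) m → sum (λ l → f l * δ m (toℕ l)) ≡ pad f (suc m)
sum-δʳ f m = trans (sum-cong-≗ (λ l → cong (f l *_) (δ-sym m (toℕ l)))) (sum-δ f m)

sum-δ-sucʳ : ∀ {n} (f : Fin n → ℚ) m → sum (λ l → f l * δ m (suc (toℕ l))) ≡ pad f m
sum-δ-sucʳ f m = trans (sum-cong-≗ (λ l → cong (f l *_) (δ-sym m (suc (toℕ l))))) (sum-δ-suc f m)

sum-*e : ∀ {n} (w : Vec n) i → sum (λ l → w l * e l i) ≡ w i
sum-*e w i = trans (sum-cong-≗ (λ l → cong (w l *_) (e≡δ l i))) (trans (sum-δʳ w (toℕ i)) (padWith-toℕ 0ℚ w i))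

sum-e* : ∀ {n} (f : Vec n) k → sum (λ l → e k l * f l) ≡ f k
sum-e* f k = trans (sum-cong-≗ (λ l → trans (QP.*-comm (e k l) (f l)) (cong (f l *_) (e≡δ k l))))
                   (trans (sum-δ f (toℕ k)) (padWith-toℕ 0ℚ f k))

dot-e : ∀ {n} (u : Vec n) i → dot u (e i) ≡ u i
dot-e u i = begin
  sumFin (λ l → u l * e i l)   ≡⟨ sumFin≡sum (λ l → u l * e i l) ⟩
  sum (λ l → u l * e i l)      ≡⟨ sum-cong-≗ (λ l → cong (u l *_) (e≡δ i l)) ⟩
  sum (λ l → u l * δ (toℕ l) (toℕ i)) ≡⟨ sum-δ u (toℕ i) ⟩
  pad u (suc (toℕ i))          ≡⟨ padWith-toℕ 0ℚ u i ⟩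
  u i                          ∎
  where open ≡-Reasoning

α≡δ : ∀ {n} q (k i : Fin n) →
  α q k i ≡ (q + 1ℚ) * δ (toℕ i) (toℕ k) + - 1ℚ * δ (suc (toℕ i)) (toℕ k) + - q * δ (toℕ i) (suc (toℕ k))
α≡δ q k i = entry (toℕ i) (toℕ k)
  where
  entry : ∀ t s →
    (if ⌊ t ℕ.≟ s ⌋ then q + 1ℚ else if ⌊ suc t ℕ.≟ s ⌋ then - 1ℚ else if ⌊ t ℕ.≟ suc s ⌋ then - q else 0ℚ)
      ≡ (q + 1ℚ) * δ t s + - 1ℚ * δ (suc t) s + - q * δ t (suc s)
  entry t s rewrite ⌊≟⌋≡≡ᵇ t s | ⌊≟⌋≡≡ᵇ (suc t) s | ⌊≟⌋≡≡ᵇ t (suc s) = go t s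
    where
    go : ∀ t s → (if t ≡ᵇ s then q + 1ℚ else if suc t ≡ᵇ s then - 1ℚ else if t ≡ᵇ suc s then - q else 0ℚ)
                 ≡ (q + 1ℚ) * δ t s + - 1ℚ * δ (suc t) s + - q * δ t (suc s)
    go zero zero = solve 1 (λ q → q :+ con 1ℚ
      := (q :+ con 1ℚ) :* con 1ℚ :+ con (- 1ℚ) :* con 0ℚ :+ (:- q) :* con 0ℚ) refl q
    go zero (suc zero) = solve 1 (λ q → con (- 1ℚ)
      := (q :+ con 1ℚ) :* con 0ℚ :+ con (- 1ℚ) :* con 1ℚ :+ (:- q) :* con 0ℚ) refl q
    go zero (suc (suc s)) = solve 1 (λ q → con 0ℚ
      := (q :+ con 1ℚ) :* con 0ℚ :+ con (- 1ℚ) :* con 0ℚ :+ (:- q) :* con 0ℚ) refl q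
    go (suc zero) zero = solve 1 (λ q → :- q
      := (q :+ con 1ℚ) :* con 0ℚ :+ con (- 1ℚ) :* con 0ℚ :+ (:- q) :* con 1ℚ) refl q
    go (suc (suc t)) zero = solve 1 (λ q → con 0ℚ
      := (q :+ con 1ℚ) :* con 0ℚ :+ con (- 1ℚ) :* con 0ℚ :+ (:- q) :* con 0ℚ) refl q
    go (suc t) (suc s) = go t s

A : ∀ {n} → ℚ → Vec n → Vec n
A q z i = sum (λ k → z k * α q k i)

Aseq : ℚ → (ℕ → ℚ) → ℕ → ℚ
Aseq q Z m = (q + 1ℚ) * Z (suc m) - Z (suc (suc m)) - q * Z m

Aᵀseq : ℚ → (ℕ → ℚ) → ℕ → ℚ
Aᵀseq q U m = (q + 1ℚ) * U (suc m) - U m - q * U (suc (suc m))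

combination≡differences : ∀ q x y z → (q + 1ℚ) * x + - 1ℚ * y + - q * z ≡ (q + 1ℚ) * x - y - q * z
combination≡differences = solve 4 (λ q x y z → (q :+ con 1ℚ) :* x :+ con (- 1ℚ) :* y :+ (:- q) :* z
                                    := (q :+ con 1ℚ) :* x :- y :- q :* z) refl

A≡Aseq : ∀ {n} q (z : Vec n) i → A q z i ≡ Aseq q (pad z) (toℕ i)
A≡Aseq q z i = begin
  sum (λ k → z k * α q k i)
    ≡⟨ sum-cong-≗ (λ k → cong (z k *_) (α≡δ q k i)) ⟩
  sum (λ k → z k * ((q + 1ℚ) * δ t (toℕ k) + - 1ℚ * δ (suc t) (toℕ k) + - q * δ t (suc (toℕ k))))
    ≡⟨ sum-*-combination z (λ k → δ t (toℕ k)) (λ k → δ (suc t) (toℕ k)) (λ k → δ t (suc (toℕ k)))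
                         (q + 1ℚ) (- 1ℚ) (- q) ⟩
  (q + 1ℚ) * sum (λ k → z k * δ t (toℕ k)) + - 1ℚ * sum (λ k → z k * δ (suc t) (toℕ k))
    + - q * sum (λ k → z k * δ t (suc (toℕ k)))
    ≡⟨ cong₂ _+_ (cong₂ _+_ (cong ((q + 1ℚ) *_) (sum-δʳ z t)) (cong (- 1ℚ *_) (sum-δʳ z (suc t))))
                 (cong (- q *_) (sum-δ-sucʳ z t)) ⟩
  (q + 1ℚ) * pad z (suc t) + - 1ℚ * pad z (suc (suc t)) + - q * pad z t
    ≡⟨ combination≡differences q _ _ _ ⟩
  Aseq q (pad z) t ∎
  where
  open ≡-Reasoning
  t = toℕ i

dot-α≡Aᵀseq : ∀ {n} q (u : Vec n) k → dot u (α q k) ≡ Aᵀseq q (pad u) (toℕ k)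
dot-α≡Aᵀseq q u k = begin
  sumFin (λ i → u i * α q k i)
    ≡⟨ sumFin≡sum (λ i → u i * α q k i) ⟩
  sum (λ i → u i * α q k i)
    ≡⟨ sum-cong-≗ (λ i → cong (u i *_) (α≡δ q k i)) ⟩
  sum (λ i → u i * ((q + 1ℚ) * δ (toℕ i) s + - 1ℚ * δ (suc (toℕ i)) s + - q * δ (toℕ i) (suc s)))
    ≡⟨ sum-*-combination u (λ i → δ (toℕ i) s) (λ i → δ (suc (toℕ i)) s) (λ i → δ (toℕ i) (suc s))
                         (q + 1ℚ) (- 1ℚ) (- q) ⟩
  (q + 1ℚ) * sum (λ i → u i * δ (toℕ i) s) + - 1ℚ * sum (λ i → u i * δ (suc (toℕ i)) s)
    + - q * sum (λ i → u i * δ (toℕ i) (suc s))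
    ≡⟨ cong₂ _+_ (cong₂ _+_ (cong ((q + 1ℚ) *_) (sum-δ u s)) (cong (- 1ℚ *_) (sum-δ-suc u s)))
                 (cong (- q *_) (sum-δ u (suc s))) ⟩
  (q + 1ℚ) * pad u (suc s) + - 1ℚ * pad u s + - q * pad u (suc (suc s))
    ≡⟨ combination≡differences q _ _ _ ⟩
  Aᵀseq q (pad u) s ∎
  where
  open ≡-Reasoning
  s = toℕ k

A-zero : ∀ {n} q (i : Fin n) → A q zeroV i ≡ 0ℚ
A-zero q i = sum-≡0 (λ k → QP.*-zeroˡ (α q k i))

A-cong : ∀ {n} q {z z′ : Vec n} → (∀ k → z k ≡ z′ k) → ∀ i → A q z i ≡ A q z′ i
A-cong q z≗z′ i = sum-cong-≗ (λ k → cong (_* α q k i) (z≗z′ k))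

A-sub : ∀ {n} q (z z′ : Vec n) i → A q (λ k → z k - z′ k) i ≡ A q z i - A q z′ i
A-sub q z z′ i = begin
  sum (λ k → (z k - z′ k) * α q k i)
    ≡⟨ sum-cong-≗ (λ k → solve 3 (λ a b c → (a :- b) :* c := a :* c :+ :- (b :* c)) refl (z k) (z′ k) (α q k i)) ⟩
  sum (λ k → z k * α q k i + - (z′ k * α q k i))
    ≡⟨ ∑-distrib-+ (λ k → z k * α q k i) (λ k → - (z′ k * α q k i)) ⟩
  A q z i + sum (λ k → - (z′ k * α q k i))
    ≡⟨ cong (A q z i +_) (sum-neg (λ k → z′ k * α q k i)) ⟩
  A q z i - A q z′ i ∎
  where open ≡-Reasoning

dot-negV : ∀ {n} (u v : Vec n) → dot u (negV v) ≡ - dot u v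
dot-negV u v = begin
  sumFin (λ i → u i * - v i)   ≡⟨ sumFin≡sum (λ i → u i * - v i) ⟩
  sum (λ i → u i * - v i)      ≡⟨ sum-cong-≗ (λ i → solve 2 (λ a b → a :* (:- b) := :- (a :* b)) refl (u i) (v i)) ⟩
  sum (λ i → - (u i * v i))    ≡⟨ sum-neg (λ i → u i * v i) ⟩
  - sum (λ i → u i * v i)      ≡⟨ cong -_ (sumFin≡sum (λ i → u i * v i)) ⟨
  - dot u v                    ∎
  where open ≡-Reasoning

A-transpose : ∀ {n} q (u z : Vec n) → sum (λ i → u i * A q z i) ≡ sum (λ k → z k * dot u (α q k))
A-transpose q u z = begin
  sum (λ i → u i * sum (λ k → z k * α q k i))
    ≡⟨ sum-cong-≗ (λ i → *-distribˡ-sum (u i) (λ k → z k * α q k i)) ⟩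
  sum (λ i → sum (λ k → u i * (z k * α q k i)))
    ≡⟨ ∑-comm (λ i k → u i * (z k * α q k i)) ⟩
  sum (λ k → sum (λ i → u i * (z k * α q k i)))
    ≡⟨ sum-cong-≗ (λ k → sum-cong-≗ (λ i →
         solve 3 (λ u z a → u :* (z :* a) := z :* (u :* a)) refl (u i) (z k) (α q k i))) ⟩
  sum (λ k → sum (λ i → z k * (u i * α q k i)))
    ≡⟨ sum-cong-≗ (λ k → trans (sym (*-distribˡ-sum (z k) (λ i → u i * α q k i)))
                               (cong (z k *_) (sym (sumFin≡sum (λ i → u i * α q k i))))) ⟩
  sum (λ k → z k * dot u (α q k)) ∎
  where open ≡-Reasoning

-- Sign non-reversal

module SignNonReversal {q : ℚ} (0<q : 0ℚ < q) where

  private instance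
    q≢0 : NonZero q
    q≢0 = QP.pos⇒nonZero q {{Q.positive 0<q}}

  weight : ℕ → ℚ
  weight zero = 1ℚ
  weight (suc m) = weight m * 1/ q

  weight-pos : ∀ m → 0ℚ < weight m
  weight-pos zero = QP.positive⁻¹ 1ℚ
  weight-pos (suc m) = QP.positive⁻¹ _
    {{QP.pos*pos⇒pos (weight m) {{Q.positive (weight-pos m)}} (1/ q) {{QP.1/pos⇒pos q {{Q.positive 0<q}}}}}}

  energy-step : ∀ w x y z →
    w * (x * (x - y)) + w * 1/ q * (y * ((q + 1ℚ) * y - z - q * x))
      ≡ w * ((x - y) * (x - y)) + w * 1/ q * (y * (y - z))
  energy-step w x y z = begin
    w * (x * (x - y)) + w * r * (y * ((q + 1ℚ) * y - z - q * x))
      ≡⟨ solve 6 (λ w x y z r q → w :* (x :* (x :- y)) :+ w :* r :* (y :* ((q :+ con 1ℚ) :* y :- z :- q :* x))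
                               := w :* ((x :- y) :* (x :- y)) :+ w :* r :* (y :* (y :- z))
                                  :+ w :* y :* (y :- x) :* (r :* q :- con 1ℚ)) refl w x y z r q ⟩
    w * ((x - y) * (x - y)) + w * r * (y * (y - z)) + w * y * (y - x) * (r * q - 1ℚ)
      ≡⟨ cong (λ t → w * ((x - y) * (x - y)) + w * r * (y * (y - z)) + w * y * (y - x) * (t - 1ℚ))
              (QP.*-inverseˡ q) ⟩
    w * ((x - y) * (x - y)) + w * r * (y * (y - z)) + w * y * (y - x) * (1ℚ - 1ℚ)
      ≡⟨ solve 5 (λ w x y z r → w :* ((x :- y) :* (x :- y)) :+ w :* r :* (y :* (y :- z))
                                 :+ w :* y :* (y :- x) :* (con 1ℚ :- con 1ℚ)
                             := w :* ((x :- y) :* (x :- y)) :+ w :* r :* (y :* (y :- z))) refl w x y z r ⟩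
    w * ((x - y) * (x - y)) + w * r * (y * (y - z)) ∎
    where
    open ≡-Reasoning
    r = 1/ q

  module _ (Z : ℕ → ℚ) (Z0≡0 : Z 0 ≡ 0ℚ) where

    Δ² : ℕ → ℚ
    Δ² m = (Z m - Z (suc m)) * (Z m - Z (suc m))

    -- Summation by parts; once Z (suc N) = 0 the right-hand side is a sum of squares.
    energy : ∀ N → sumN N (λ m → weight (suc m) * (Z (suc m) * Aseq q Z m))
                   ≡ sumN N (λ m → weight m * Δ² m) + weight N * (Z N * (Z N - Z (suc N)))
    energy zero = begin
      0ℚ
        ≡⟨ solve 1 (λ y → con 0ℚ := con 0ℚ :+ con 1ℚ :* (con 0ℚ :* (con 0ℚ :- y))) refl (Z 1) ⟩
      0ℚ + 1ℚ * (0ℚ * (0ℚ - Z 1))      ≡⟨ cong (λ x → 0ℚ + 1ℚ * (x * (x - Z 1))) (sym Z0≡0) ⟩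
      0ℚ + 1ℚ * (Z 0 * (Z 0 - Z 1))    ∎
      where open ≡-Reasoning
    energy (suc N) = begin
      S + weight (suc N) * (Z (suc N) * Aseq q Z N)
        ≡⟨ cong (_+ weight (suc N) * (Z (suc N) * Aseq q Z N)) (energy N) ⟩
      T + weight N * (Z N * (Z N - Z (suc N))) + weight (suc N) * (Z (suc N) * Aseq q Z N)
        ≡⟨ QP.+-assoc T _ _ ⟩
      T + (weight N * (Z N * (Z N - Z (suc N))) + weight (suc N) * (Z (suc N) * Aseq q Z N))
        ≡⟨ cong (T +_) (energy-step (weight N) (Z N) (Z (suc N)) (Z (suc (suc N)))) ⟩
      T + (weight N * Δ² N + weight (suc N) * (Z (suc N) * (Z (suc N) - Z (suc (suc N)))))
        ≡⟨ sym (QP.+-assoc T _ _) ⟩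
      T + weight N * Δ² N + weight (suc N) * (Z (suc N) * (Z (suc N) - Z (suc (suc N)))) ∎
      where
      open ≡-Reasoning
      S = sumN N (λ m → weight (suc m) * (Z (suc m) * Aseq q Z m))
      T = sumN N (λ m → weight m * Δ² m)

    differences-vanish : ∀ N → Z (suc N) ≡ 0ℚ → (∀ m → m ℕ.< N → Z (suc m) * Aseq q Z m ≤ 0ℚ) →
                         ∀ m → m ℕ.< N → Z m ≡ Z (suc m)
    differences-vanish N ZN+1≡0 ZAZ≤0 m m<N =
      p-q≡0⇒p≡q (Z m) (Z (suc m))
        (square≡0⇒≡0 _ (≢0*≡0⇒≡0 (pos⇒≢0 (weight-pos m)) (sumN-nonNeg-≡0 N T≥0 T≡0 m m<N)))
      where
      T≥0 : ∀ m → 0ℚ ≤ weight m * Δ² m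
      T≥0 m = *-nonNeg (QP.<⇒≤ (weight-pos m)) (square-nonNeg (Z m - Z (suc m)))
      boundary≥0 : 0ℚ ≤ weight N * (Z N * (Z N - Z (suc N)))
      boundary≥0 = *-nonNeg (QP.<⇒≤ (weight-pos N))
        (subst (λ t → 0ℚ ≤ Z N * (Z N - t)) (sym ZN+1≡0)
          (subst (0ℚ ≤_) (solve 1 (λ x → x :* x := x :* (x :- con 0ℚ)) refl (Z N)) (square-nonNeg (Z N))))
      energy≤0 : sumN N (λ m → weight m * Δ² m) + weight N * (Z N * (Z N - Z (suc N))) ≤ 0ℚ
      energy≤0 = subst (_≤ 0ℚ) (energy N)
        (sumN-nonPos N (λ m m<N → *-nonNeg-nonPos (QP.<⇒≤ (weight-pos (suc m))) (ZAZ≤0 m m<N)))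
      T≡0 : sumN N (λ m → weight m * Δ² m) ≡ 0ℚ
      T≡0 = +-nonNeg-≡0ˡ (sumN-nonNeg N T≥0) boundary≥0
              (QP.≤-antisym energy≤0 (+-nonNeg (sumN-nonNeg N T≥0) boundary≥0))

    vanishes : ∀ N → Z (suc N) ≡ 0ℚ → (∀ m → m ℕ.< N → Z (suc m) * Aseq q Z m ≤ 0ℚ) →
               ∀ m → m ℕ.≤ N → Z m ≡ 0ℚ
    vanishes N ZN+1≡0 ZAZ≤0 zero _ = Z0≡0
    vanishes N ZN+1≡0 ZAZ≤0 (suc m) m<N =
      trans (sym (differences-vanish N ZN+1≡0 ZAZ≤0 m m<N)) (vanishes N ZN+1≡0 ZAZ≤0 m (ℕP.<⇒≤ m<N))

signNonReversal : ∀ {n} {q} → 0ℚ < q → (z : Vec n) → (∀ i → z i * A q z i ≤ 0ℚ) → ∀ i → z i ≡ 0ℚ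
signNonReversal {n} {q} 0<q z zAz≤0 i =
  trans (sym (padWith-toℕ 0ℚ z i))
        (vanishes (pad z) (padWith-zero 0ℚ z) n (padWith-suc-n 0ℚ z) ZAZ≤0 (suc (toℕ i)) (FP.toℕ<n i))
  where
  open SignNonReversal 0<q
  ZAZ≤0 : ∀ m → m ℕ.< n → pad z (suc m) * Aseq q (pad z) m ≤ 0ℚ
  ZAZ≤0 m m<n = subst (λ t → pad z (suc t) * Aseq q (pad z) t ≤ 0ℚ) (FP.toℕ-fromℕ< m<n)
    (subst (_≤ 0ℚ) (cong₂ _*_ (sym (padWith-toℕ 0ℚ z j)) (A≡Aseq q z j)) (zAz≤0 j))
    where j = F.fromℕ< m<n

-- Representations x = w − A z

NonNeg : ∀ {n} → Vec n → Set
NonNeg w = ∀ i → 0ℚ ≤ w i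

SupportedOn : ∀ {n} → Subset n → Vec n → Set
SupportedOn J w = ∀ i → i ∉ J → w i ≡ 0ℚ

disjoint-supports : ∀ {n} {J K : Subset n} {w z : Vec n} →
  Disjoint J K → SupportedOn J w → SupportedOn K z → ∀ i → z i * w i ≡ 0ℚ
disjoint-supports {J = J} {K} {w} {z} J∩K≡∅ w⊆J z⊆K i with i ∈? K
... | yes i∈K = trans (cong (z i *_) (w⊆J i (λ i∈J → J∩K≡∅ i i∈J i∈K))) (QP.*-zeroʳ (z i))
... | no i∉K = trans (cong (_* w i) (z⊆K i i∉K)) (QP.*-zeroˡ (w i))

module _ {n} {J J₀ : Subset n} {w : Vec n} where

  supported-∩⁺ : SupportedOn J w → SupportedOn J₀ w → SupportedOn (J ∩ J₀) w
  supported-∩⁺ w⊆J w⊆J₀ i i∉J∩J₀ with i ∈? J | i ∈? J₀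
  ... | no i∉J | _ = w⊆J i i∉J
  ... | yes _ | no i∉J₀ = w⊆J₀ i i∉J₀
  ... | yes i∈J | yes i∈J₀ = ⊥-elim (i∉J∩J₀ (x∈p∩q⁺ (i∈J , i∈J₀)))

  supported-∩⁻ˡ : SupportedOn (J ∩ J₀) w → SupportedOn J w
  supported-∩⁻ˡ w⊆J∩J₀ i i∉J = w⊆J∩J₀ i (i∉J ∘ p∩q⊆p J J₀)

  supported-∩⁻ʳ : SupportedOn (J ∩ J₀) w → SupportedOn J₀ w
  supported-∩⁻ʳ w⊆J∩J₀ i i∉J₀ = w⊆J∩J₀ i (i∉J₀ ∘ p∩q⊆q J J₀)

record Representation {n} (q : ℚ) (J K : Subset n) (x : Vec n) : Set where
  constructor representation
  field
    w z : Vec n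
    w≥0 : NonNeg w
    z≥0 : NonNeg z
    w⊆J : SupportedOn J w
    z⊆K : SupportedOn K z
    x≡w-Az : ∀ i → x i ≡ w i - A q z i

withSupports : ∀ {n} {q} {J K J′ K′ : Subset n} {x} (R : Representation q J K x) →
  SupportedOn J′ (Representation.w R) → SupportedOn K′ (Representation.z R) → Representation q J′ K′ x
withSupports (representation w z w≥0 z≥0 _ _ x≡w-Az) w⊆J′ z⊆K′ = representation w z w≥0 z≥0 w⊆J′ z⊆K′ x≡w-Az

module _ {n} {q} {J K J′ K′ : Subset n} {x} (R : Representation q J K x) (R′ : Representation q J′ K′ x) where
  open Representation R
  open Representation R′ using () renaming
    (w to w′; z to z′; w≥0 to w′≥0; z≥0 to z′≥0; w⊆J to w′⊆J′; z⊆K to z′⊆K′; x≡w-Az to x≡w′-Az′)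

  A-difference : ∀ i → A q (λ k → z k - z′ k) i ≡ w i - w′ i
  A-difference i = begin
    A q (λ k → z k - z′ k) i    ≡⟨ A-sub q z z′ i ⟩
    A q z i - A q z′ i          ≡⟨ solve 4 (λ w w′ a a′ → a :- a′ := (w′ :- a′) :- (w :- a) :+ (w :- w′)) refl
                                           (w i) (w′ i) (A q z i) (A q z′ i) ⟩
    (w′ i - A q z′ i) - (w i - A q z i) + (w i - w′ i)
                                ≡⟨ cong (_+ (w i - w′ i)) (cong₂ _-_ (sym (x≡w′-Az′ i)) (sym (x≡w-Az i))) ⟩
    x i - x i + (w i - w′ i)    ≡⟨ solve 2 (λ x d → x :- x :+ d := d) refl (x i) (w i - w′ i) ⟩
    w i - w′ i                  ∎
    where open ≡-Reasoning

  difference-reverses-signs : Disjoint J K → Disjoint J′ K′ → ∀ i → (z i - z′ i) * A q (λ k → z k - z′ k) i ≤ 0ℚ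
  difference-reverses-signs J∩K≡∅ J′∩K′≡∅ i =
    subst (_≤ 0ℚ) (sym product) (QP.neg-antimono-≤ (+-nonNeg (*-nonNeg (z≥0 i) (w′≥0 i)) (*-nonNeg (z′≥0 i) (w≥0 i))))
    where
    open ≡-Reasoning
    product : (z i - z′ i) * A q (λ k → z k - z′ k) i ≡ - (z i * w′ i + z′ i * w i)
    product = begin
      (z i - z′ i) * A q (λ k → z k - z′ k) i
        ≡⟨ cong ((z i - z′ i) *_) (A-difference i) ⟩
      (z i - z′ i) * (w i - w′ i)
        ≡⟨ solve 4 (λ z z′ w w′ → (z :- z′) :* (w :- w′) := :- (z :* w′ :+ z′ :* w) :+ z :* w :+ z′ :* w′)
                   refl (z i) (z′ i) (w i) (w′ i) ⟩
      - (z i * w′ i + z′ i * w i) + z i * w i + z′ i * w′ i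
        ≡⟨ cong₂ (λ s t → - (z i * w′ i + z′ i * w i) + s + t)
                 (disjoint-supports J∩K≡∅ w⊆J z⊆K i) (disjoint-supports J′∩K′≡∅ w′⊆J′ z′⊆K′ i) ⟩
      - (z i * w′ i + z′ i * w i) + 0ℚ + 0ℚ
        ≡⟨ solve 1 (λ a → a :+ con 0ℚ :+ con 0ℚ := a) refl (- (z i * w′ i + z′ i * w i)) ⟩
      - (z i * w′ i + z′ i * w i) ∎

  representation-unique : 0ℚ < q → Disjoint J K → Disjoint J′ K′ → (∀ i → w i ≡ w′ i) × (∀ i → z i ≡ z′ i)
  representation-unique 0<q J∩K≡∅ J′∩K′≡∅ = w≡w′ , z≡z′
    where
    z≡z′ : ∀ i → z i ≡ z′ i
    z≡z′ i = p-q≡0⇒p≡q (z i) (z′ i)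
      (signNonReversal 0<q (λ k → z k - z′ k) (difference-reverses-signs J∩K≡∅ J′∩K′≡∅) i)
    w≡w′ : ∀ i → w i ≡ w′ i
    w≡w′ i = begin
      w i                          ≡⟨ solve 2 (λ w a → w := (w :- a) :+ a) refl (w i) (A q z i) ⟩
      (w i - A q z i) + A q z i    ≡⟨ cong₂ _+_ (trans (sym (x≡w-Az i)) (x≡w′-Az′ i)) (A-cong q z≡z′ i) ⟩
      (w′ i - A q z′ i) + A q z′ i ≡⟨ solve 2 (λ w a → (w :- a) :+ a := w) refl (w′ i) (A q z′ i) ⟩
      w′ i                         ∎
      where open ≡-Reasoning

Coeffs : ∀ {n} → List (Vec n) → Set
Coeffs L = Fin (length L) → ℚ

leftCoeffs : ∀ {n} (L₁ L₂ : List (Vec n)) → Coeffs (L₁ ++ L₂) → Coeffs L₁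
leftCoeffs (v ∷ L₁) L₂ c F.zero = c F.zero
leftCoeffs (v ∷ L₁) L₂ c (F.suc j) = leftCoeffs L₁ L₂ (c ∘ F.suc) j

rightCoeffs : ∀ {n} (L₁ L₂ : List (Vec n)) → Coeffs (L₁ ++ L₂) → Coeffs L₂
rightCoeffs [] L₂ c = c
rightCoeffs (v ∷ L₁) L₂ c = rightCoeffs L₁ L₂ (c ∘ F.suc)

appendCoeffs : ∀ {n} (L₁ L₂ : List (Vec n)) → Coeffs L₁ → Coeffs L₂ → Coeffs (L₁ ++ L₂)
appendCoeffs [] L₂ c₁ c₂ = c₂
appendCoeffs (v ∷ L₁) L₂ c₁ c₂ F.zero = c₁ F.zero
appendCoeffs (v ∷ L₁) L₂ c₁ c₂ (F.suc j) = appendCoeffs L₁ L₂ (c₁ ∘ F.suc) c₂ j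

linComb-++ : ∀ {n} (L₁ L₂ : List (Vec n)) c i →
  linComb (L₁ ++ L₂) c i ≡ linComb L₁ (leftCoeffs L₁ L₂ c) i + linComb L₂ (rightCoeffs L₁ L₂ c) i
linComb-++ [] L₂ c i = sym (QP.+-identityˡ _)
linComb-++ (v ∷ L₁) L₂ c i =
  trans (cong (c F.zero * v i +_) (linComb-++ L₁ L₂ (c ∘ F.suc) i)) (sym (QP.+-assoc (c F.zero * v i) _ _))

linComb-appendCoeffs : ∀ {n} (L₁ L₂ : List (Vec n)) c₁ c₂ i →
  linComb (L₁ ++ L₂) (appendCoeffs L₁ L₂ c₁ c₂) i ≡ linComb L₁ c₁ i + linComb L₂ c₂ i
linComb-appendCoeffs [] L₂ c₁ c₂ i = sym (QP.+-identityˡ _)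
linComb-appendCoeffs (v ∷ L₁) L₂ c₁ c₂ i =
  trans (cong (c₁ F.zero * v i +_) (linComb-appendCoeffs L₁ L₂ (c₁ ∘ F.suc) c₂ i))
        (sym (QP.+-assoc (c₁ F.zero * v i) _ _))

leftCoeffs-nonNeg : ∀ {n} (L₁ L₂ : List (Vec n)) {c} → (∀ j → 0ℚ ≤ c j) → ∀ j → 0ℚ ≤ leftCoeffs L₁ L₂ c j
leftCoeffs-nonNeg (v ∷ L₁) L₂ c≥0 F.zero = c≥0 F.zero
leftCoeffs-nonNeg (v ∷ L₁) L₂ c≥0 (F.suc j) = leftCoeffs-nonNeg L₁ L₂ (c≥0 ∘ F.suc) j

rightCoeffs-nonNeg : ∀ {n} (L₁ L₂ : List (Vec n)) {c} → (∀ j → 0ℚ ≤ c j) → ∀ j → 0ℚ ≤ rightCoeffs L₁ L₂ c j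
rightCoeffs-nonNeg [] L₂ c≥0 = c≥0
rightCoeffs-nonNeg (v ∷ L₁) L₂ c≥0 = rightCoeffs-nonNeg L₁ L₂ (c≥0 ∘ F.suc)

appendCoeffs-nonNeg : ∀ {n} (L₁ L₂ : List (Vec n)) {c₁ c₂} → (∀ j → 0ℚ ≤ c₁ j) → (∀ j → 0ℚ ≤ c₂ j) →
                      ∀ j → 0ℚ ≤ appendCoeffs L₁ L₂ c₁ c₂ j
appendCoeffs-nonNeg [] L₂ c₁≥0 c₂≥0 = c₂≥0
appendCoeffs-nonNeg (v ∷ L₁) L₂ c₁≥0 c₂≥0 F.zero = c₁≥0 F.zero
appendCoeffs-nonNeg (v ∷ L₁) L₂ c₁≥0 c₂≥0 (F.suc j) = appendCoeffs-nonNeg L₁ L₂ (c₁≥0 ∘ F.suc) c₂≥0 j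

split≡0⇒≡0 : ∀ {n} (L₁ L₂ : List (Vec n)) {c} →
  (∀ j → leftCoeffs L₁ L₂ c j ≡ 0ℚ) → (∀ j → rightCoeffs L₁ L₂ c j ≡ 0ℚ) → ∀ j → c j ≡ 0ℚ
split≡0⇒≡0 [] L₂ _ c₂≡0 = c₂≡0
split≡0⇒≡0 (v ∷ L₁) L₂ c₁≡0 c₂≡0 F.zero = c₁≡0 F.zero
split≡0⇒≡0 (v ∷ L₁) L₂ c₁≡0 c₂≡0 (F.suc j) = split≡0⇒≡0 L₁ L₂ (c₁≡0 ∘ F.suc) c₂≡0 j

-- g only fixes the index type Fin (length (map g ks)) of the coefficients.
weights : ∀ {n} (g : Fin n → Vec n) (ks : List (Fin n)) → Coeffs (map g ks) → Vec n
weights g [] c l = 0ℚ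
weights g (k ∷ ks) c l = c F.zero * e k l + weights g ks (c ∘ F.suc) l

linComb-map : ∀ {n} (g : Fin n → Vec n) ks c i → linComb (map g ks) c i ≡ sum (λ l → weights g ks c l * g l i)
linComb-map g [] c i = sym (sum-≡0 (λ l → QP.*-zeroˡ (g l i)))
linComb-map g (k ∷ ks) c i = begin
  c₀ * g k i + linComb (map g ks) (c ∘ F.suc) i
    ≡⟨ cong₂ _+_ (cong (c₀ *_) (sym (sum-e* (λ l → g l i) k))) (linComb-map g ks (c ∘ F.suc) i) ⟩
  c₀ * sum (λ l → e k l * g l i) + sum (λ l → W l * g l i)
    ≡⟨ cong (_+ sum (λ l → W l * g l i)) (*-distribˡ-sum c₀ (λ l → e k l * g l i)) ⟩
  sum (λ l → c₀ * (e k l * g l i)) + sum (λ l → W l * g l i)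
    ≡⟨ sym (∑-distrib-+ (λ l → c₀ * (e k l * g l i)) (λ l → W l * g l i)) ⟩
  sum (λ l → c₀ * (e k l * g l i) + W l * g l i)
    ≡⟨ sum-cong-≗ (λ l → solve 4 (λ c e g w → c :* (e :* g) :+ w :* g := (c :* e :+ w) :* g)
                                 refl c₀ (e k l) (g l i) (W l)) ⟩
  sum (λ l → (c₀ * e k l + W l) * g l i) ∎
  where
  open ≡-Reasoning
  c₀ = c F.zero
  W = weights g ks (c ∘ F.suc)

weights-nonNeg : ∀ {n} (g : Fin n → Vec n) ks {c} → (∀ j → 0ℚ ≤ c j) → NonNeg (weights g ks c)
weights-nonNeg g [] c≥0 l = QP.≤-refl
weights-nonNeg g (k ∷ ks) c≥0 l = +-nonNeg (*-nonNeg (c≥0 F.zero) (e-nonNeg k l)) (weights-nonNeg g ks (c≥0 ∘ F.suc) l)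

weights-outside : ∀ {n} (g : Fin n → Vec n) ks c l → ¬ (l ∈ₗ ks) → weights g ks c l ≡ 0ℚ
weights-outside g [] c l _ = refl
weights-outside g (k ∷ ks) c l l∉k∷ks = begin
  c F.zero * e k l + weights g ks (c ∘ F.suc) l
    ≡⟨ cong₂ _+_ (cong (c F.zero *_) (e-off-diagonal (l∉k∷ks ∘ here)))
                 (weights-outside g ks (c ∘ F.suc) l (l∉k∷ks ∘ there)) ⟩
  c F.zero * 0ℚ + 0ℚ
    ≡⟨ solve 1 (λ c → c :* con 0ℚ :+ con 0ℚ := con 0ℚ) refl (c F.zero) ⟩
  0ℚ ∎
  where open ≡-Reasoning

-- Zeroing W at k once its coefficient is taken makes repeated indices in ks harmless.
coeffsOf : ∀ {n} (g : Fin n → Vec n) (ks : List (Fin n)) → Vec n → Coeffs (map g ks)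
coeffsOf g (k ∷ ks) W F.zero = W k
coeffsOf g (k ∷ ks) W (F.suc j) = coeffsOf g ks (updateAt W k (λ _ → 0ℚ)) j

coeffsOf-nonNeg : ∀ {n} (g : Fin n → Vec n) ks {W} → NonNeg W → ∀ j → 0ℚ ≤ coeffsOf g ks W j
coeffsOf-nonNeg g (k ∷ ks) W≥0 F.zero = W≥0 k
coeffsOf-nonNeg g (k ∷ ks) {W} W≥0 (F.suc j) = coeffsOf-nonNeg g ks W′≥0 j
  where
  W′≥0 : NonNeg (updateAt W k (λ _ → 0ℚ))
  W′≥0 l with l FP.≟ k
  ... | yes refl = QP.≤-reflexive (sym (updateAt-updates l W))
  ... | no l≢k = subst (0ℚ ≤_) (sym (updateAt-minimal l k W l≢k)) (W≥0 l)

weights-coeffsOf : ∀ {n} (g : Fin n → Vec n) ks {W} → (∀ l → ¬ (l ∈ₗ ks) → W l ≡ 0ℚ) →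
                   ∀ l → weights g ks (coeffsOf g ks W) l ≡ W l
weights-coeffsOf g [] W⊆[] l = sym (W⊆[] l (λ ()))
weights-coeffsOf g (k ∷ ks) {W} W⊆k∷ks l =
  trans (cong (W k * e k l +_) (weights-coeffsOf g ks W′⊆ks l)) restore
  where
  W′ = updateAt W k (λ _ → 0ℚ)
  W′⊆ks : ∀ l → ¬ (l ∈ₗ ks) → W′ l ≡ 0ℚ
  W′⊆ks l l∉ks with l FP.≟ k
  ... | yes refl = updateAt-updates l W
  ... | no l≢k = trans (updateAt-minimal l k W l≢k)
                       (W⊆k∷ks l (λ { (here l≡k) → l≢k l≡k ; (there l∈ks) → l∉ks l∈ks }))
  restore : W k * e k l + W′ l ≡ W l
  restore with l FP.≟ k
  ... | yes refl = begin
    W l * e l l + W′ l ≡⟨ cong₂ (λ s t → W l * s + t) (e-diagonal l) (updateAt-updates l W) ⟩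
    W l * 1ℚ + 0ℚ      ≡⟨ solve 1 (λ w → w :* con 1ℚ :+ con 0ℚ := w) refl (W l) ⟩
    W l                ∎
    where open ≡-Reasoning
  ... | no l≢k = begin
    W k * e k l + W′ l ≡⟨ cong₂ (λ s t → W k * s + t) (e-off-diagonal l≢k) (updateAt-minimal l k W l≢k) ⟩
    W k * 0ℚ + W l     ≡⟨ solve 2 (λ v w → v :* con 0ℚ :+ w := w) refl (W k) (W l) ⟩
    W l                ∎
    where open ≡-Reasoning

weights-injective : ∀ {n} (g : Fin n → Vec n) ks {c} → Unique ks → (∀ l → weights g ks c l ≡ 0ℚ) → ∀ j → c j ≡ 0ℚ
weights-injective g (k ∷ ks) {c} (k∉ks ∷ ks-unique) W≡0 = c≡0
  where
  open ≡-Reasoning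
  W = weights g ks (c ∘ F.suc)
  c₀≡0 : c F.zero ≡ 0ℚ
  c₀≡0 = begin
    c F.zero                       ≡⟨ solve 1 (λ c → c := c :* con 1ℚ :+ con 0ℚ) refl (c F.zero) ⟩
    c F.zero * 1ℚ + 0ℚ             ≡⟨ sym (cong₂ (λ s t → c F.zero * s + t) (e-diagonal k)
                                                  (weights-outside g ks (c ∘ F.suc) k (Unique[x∷xs]⇒x∉xs (k∉ks ∷ ks-unique)))) ⟩
    c F.zero * e k k + W k         ≡⟨ W≡0 k ⟩
    0ℚ                             ∎
  W≡0′ : ∀ l → W l ≡ 0ℚ
  W≡0′ l = begin
    W l                                     ≡⟨ solve 3 (λ c e w → w := (c :* e :+ w) :- c :* e) refl (c F.zero) (e k l) (W l) ⟩
    (c F.zero * e k l + W l) - c F.zero * e k l  ≡⟨ cong₂ (λ s t → s - t * e k l) (W≡0 l) c₀≡0 ⟩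
    0ℚ - 0ℚ * e k l                         ≡⟨ solve 1 (λ e → con 0ℚ :- con 0ℚ :* e := con 0ℚ) refl (e k l) ⟩
    0ℚ                                      ∎
  c≡0 : ∀ j → c j ≡ 0ℚ
  c≡0 F.zero = c₀≡0
  c≡0 (F.suc j) = weights-injective g ks ks-unique W≡0′ j

∈ₗ-elems⁺ : ∀ {n} {J : Subset n} {l} → l ∈ J → l ∈ₗ elems J
∈ₗ-elems⁺ {J = J} {l} l∈J = ∈-filter⁺ (_∈? J) (∈-allFin l) l∈J

∈ₗ-elems⁻ : ∀ {n} {J : Subset n} {l} → l ∈ₗ elems J → l ∈ J
∈ₗ-elems⁻ {n} {J} l∈ₗJ = proj₂ (∈-filter⁻ (_∈? J) {xs = allFin n} l∈ₗJ)

elems-unique : ∀ {n} (J : Subset n) → Unique (elems J)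
elems-unique {n} J = filter⁺ (_∈? J) (allFin⁺ n)

sum-*-negα : ∀ {n} q (z : Vec n) i → sum (λ l → z l * negV (α q l) i) ≡ - A q z i
sum-*-negα q z i = trans (sum-cong-≗ (λ l → solve 2 (λ a b → a :* (:- b) := :- (a :* b)) refl (z l) (α q l i)))
                         (sum-neg (λ l → z l * α q l i))

module Generators {n} (q : ℚ) (J K : Subset n) where

  negα : Fin n → Vec n
  negα k = negV (α q k)

  Lᵉ Lᵅ : List (Vec n)
  Lᵉ = map e (elems J)
  Lᵅ = map negα (elems K)

  wOf zOf : Coeffs (gens q J K) → Vec n
  wOf c = weights e (elems J) (leftCoeffs Lᵉ Lᵅ c)
  zOf c = weights negα (elems K) (rightCoeffs Lᵉ Lᵅ c)

  wOf⊆J : ∀ c → SupportedOn J (wOf c)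
  wOf⊆J c l l∉J = weights-outside e (elems J) _ l (l∉J ∘ ∈ₗ-elems⁻)

  zOf⊆K : ∀ c → SupportedOn K (zOf c)
  zOf⊆K c l l∉K = weights-outside negα (elems K) _ l (l∉K ∘ ∈ₗ-elems⁻)

  linComb-weights : ∀ w z i → sum (λ l → w l * e l i) + sum (λ l → z l * negα l i) ≡ w i - A q z i
  linComb-weights w z i = cong₂ _+_ (sum-*e w i) (sum-*-negα q z i)

  linComb-gens : ∀ c i → linComb (gens q J K) c i ≡ wOf c i - A q (zOf c) i
  linComb-gens c i = begin
    linComb (gens q J K) c i
      ≡⟨ linComb-++ Lᵉ Lᵅ c i ⟩
    linComb Lᵉ (leftCoeffs Lᵉ Lᵅ c) i + linComb Lᵅ (rightCoeffs Lᵉ Lᵅ c) i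
      ≡⟨ cong₂ _+_ (linComb-map e (elems J) _ i) (linComb-map negα (elems K) _ i) ⟩
    sum (λ l → wOf c l * e l i) + sum (λ l → zOf c l * negα l i)
      ≡⟨ linComb-weights (wOf c) (zOf c) i ⟩
    wOf c i - A q (zOf c) i ∎
    where open ≡-Reasoning

  toRepresentation : ∀ {x} → σ q J K x → Representation q J K x
  toRepresentation (c , c≥0 , x≡Σc) = representation (wOf c) (zOf c)
    (weights-nonNeg e (elems J) (leftCoeffs-nonNeg Lᵉ Lᵅ c≥0))
    (weights-nonNeg negα (elems K) (rightCoeffs-nonNeg Lᵉ Lᵅ c≥0))
    (wOf⊆J c) (zOf⊆K c) (λ i → trans (x≡Σc i) (linComb-gens c i))

  fromRepresentation : ∀ {x} → Representation q J K x → σ q J K x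
  fromRepresentation {x} (representation w z w≥0 z≥0 w⊆J z⊆K x≡w-Az) =
    c , appendCoeffs-nonNeg Lᵉ Lᵅ (coeffsOf-nonNeg e (elems J) w≥0) (coeffsOf-nonNeg negα (elems K) z≥0) , x≡Σc
    where
    cʷ = coeffsOf e (elems J) w
    cᶻ = coeffsOf negα (elems K) z
    c = appendCoeffs Lᵉ Lᵅ cʷ cᶻ
    w⊆elemsJ : ∀ l → ¬ (l ∈ₗ elems J) → w l ≡ 0ℚ
    w⊆elemsJ l l∉ₗJ = w⊆J l (l∉ₗJ ∘ ∈ₗ-elems⁺)
    z⊆elemsK : ∀ l → ¬ (l ∈ₗ elems K) → z l ≡ 0ℚ
    z⊆elemsK l l∉ₗK = z⊆K l (l∉ₗK ∘ ∈ₗ-elems⁺)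
    x≡Σc : x ≗V linComb (gens q J K) c
    x≡Σc i = begin
      x i
        ≡⟨ x≡w-Az i ⟩
      w i - A q z i
        ≡⟨ linComb-weights w z i ⟨
      sum (λ l → w l * e l i) + sum (λ l → z l * negα l i)
        ≡⟨ cong₂ _+_ (sum-cong-≗ (λ l → cong (_* e l i) (weights-coeffsOf e (elems J) w⊆elemsJ l)))
                     (sum-cong-≗ (λ l → cong (_* negα l i) (weights-coeffsOf negα (elems K) z⊆elemsK l))) ⟨
      sum (λ l → weights e (elems J) cʷ l * e l i) + sum (λ l → weights negα (elems K) cᶻ l * negα l i)
        ≡⟨ cong₂ _+_ (linComb-map e (elems J) cʷ i) (linComb-map negα (elems K) cᶻ i) ⟨
      linComb Lᵉ cʷ i + linComb Lᵅ cᶻ i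
        ≡⟨ linComb-appendCoeffs Lᵉ Lᵅ cʷ cᶻ i ⟨
      linComb (gens q J K) c i ∎
      where open ≡-Reasoning

  gens-linIndep : 0ℚ < q → Disjoint J K → LinIndep (gens q J K)
  gens-linIndep 0<q J∩K≡∅ c Σc≡0 =
    split≡0⇒≡0 Lᵉ Lᵅ (weights-injective e (elems J) (elems-unique J) w≡0)
                      (weights-injective negα (elems K) (elems-unique K) z≡0)
    where
    w z : Vec n
    w = wOf c
    z = zOf c
    w≡Az : ∀ i → w i ≡ A q z i
    w≡Az i = p-q≡0⇒p≡q (w i) (A q z i) (trans (sym (linComb-gens c i)) (Σc≡0 i))
    z≡0 : ∀ i → z i ≡ 0ℚ
    z≡0 = signNonReversal 0<q z (λ i → QP.≤-reflexive (trans (cong (z i *_) (sym (w≡Az i)))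
      (disjoint-supports J∩K≡∅ (wOf⊆J c) (zOf⊆K c) i)))
    w≡0 : ∀ i → w i ≡ 0ℚ
    w≡0 i = trans (w≡Az i) (trans (A-cong q z≡0 i) (A-zero q i))

module _ {n} {q : ℚ} {J K : Subset n} {x : Vec n} where

  σ⇒representation : σ q J K x → Representation q J K x
  σ⇒representation = Generators.toRepresentation q J K

  representation⇒σ : Representation q J K x → σ q J K x
  representation⇒σ = Generators.fromRepresentation q J K

-- Faces cut out by functionals

dot-representation : ∀ {n} q (u x w z : Vec n) → (∀ i → x i ≡ w i - A q z i) →
  dot u x ≡ sum (λ i → w i * u i + z i * dot u (negV (α q i)))
dot-representation q u x w z x≡w-Az = begin
  sumFin (λ i → u i * x i)
    ≡⟨ sumFin≡sum (λ i → u i * x i) ⟩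
  sum (λ i → u i * x i)
    ≡⟨ sum-cong-≗ (λ i → trans (cong (u i *_) (x≡w-Az i))
                               (solve 3 (λ u w a → u :* (w :- a) := w :* u :+ :- (u :* a)) refl (u i) (w i) (A q z i))) ⟩
  sum (λ i → w i * u i + - (u i * A q z i))
    ≡⟨ ∑-distrib-+ (λ i → w i * u i) (λ i → - (u i * A q z i)) ⟩
  sum (λ i → w i * u i) + sum (λ i → - (u i * A q z i))
    ≡⟨ cong (sum (λ i → w i * u i) +_) (trans (sum-neg (λ i → u i * A q z i)) (cong -_ (A-transpose q u z))) ⟩
  sum (λ i → w i * u i) + - sum (λ k → z k * dot u (α q k))
    ≡⟨ cong (sum (λ i → w i * u i) +_) (trans (sum-cong-≗ z-dot-negα) (sum-neg (λ k → z k * dot u (α q k)))) ⟨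
  sum (λ i → w i * u i) + sum (λ k → z k * dot u (negV (α q k)))
    ≡⟨ ∑-distrib-+ (λ i → w i * u i) (λ k → z k * dot u (negV (α q k))) ⟨
  sum (λ i → w i * u i + z i * dot u (negV (α q i))) ∎
  where
  open ≡-Reasoning
  z-dot-negα : ∀ k → z k * dot u (negV (α q k)) ≡ - (z k * dot u (α q k))
  z-dot-negα k = trans (cong (z k *_) (dot-negV u (α q k)))
                       (solve 2 (λ a b → a :* (:- b) := :- (a :* b)) refl (z k) (dot u (α q k)))

module Face {n} (q : ℚ) (u : Vec n) (J K J₀ K₀ : Subset n)
  (u-on-J : ∀ i → i ∈ J → 0ℚ ≤ u i × (i ∈ J₀ ⇔ u i ≡ 0ℚ))
  (u-on-K : ∀ k → k ∈ K → 0ℚ ≤ dot u (negV (α q k)) × (k ∈ K₀ ⇔ dot u (negV (α q k)) ≡ 0ℚ)) where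

  d : Fin n → ℚ
  d k = dot u (negV (α q k))

  module _ {x} (R : Representation q J K x) where
    open Representation R

    wu≥0 : ∀ i → 0ℚ ≤ w i * u i
    wu≥0 i with i ∈? J
    ... | yes i∈J = *-nonNeg (w≥0 i) (proj₁ (u-on-J i i∈J))
    ... | no i∉J = QP.≤-reflexive (sym (≡0⊎≡0⇒*≡0 (inj₁ (w⊆J i i∉J))))

    zd≥0 : ∀ i → 0ℚ ≤ z i * d i
    zd≥0 i with i ∈? K
    ... | yes i∈K = *-nonNeg (z≥0 i) (proj₁ (u-on-K i i∈K))
    ... | no i∉K = QP.≤-reflexive (sym (≡0⊎≡0⇒*≡0 (inj₁ (z⊆K i i∉K))))

    terms≥0 : ∀ i → 0ℚ ≤ w i * u i + z i * d i
    terms≥0 i = +-nonNeg (wu≥0 i) (zd≥0 i)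

    dot≡terms : dot u x ≡ sum (λ i → w i * u i + z i * d i)
    dot≡terms = dot-representation q u x w z x≡w-Az

    dot-nonNeg : 0ℚ ≤ dot u x
    dot-nonNeg = subst (0ℚ ≤_) (sym dot≡terms) (sum-nonNeg terms≥0)

    kernel⇒supported : dot u x ≡ 0ℚ → SupportedOn J₀ w × SupportedOn K₀ z
    kernel⇒supported dot≡0 = w⊆J₀ , z⊆K₀
      where
      terms≡0 : ∀ i → w i * u i + z i * d i ≡ 0ℚ
      terms≡0 = sum-nonNeg-≡0 terms≥0 (trans (sym dot≡terms) dot≡0)
      w⊆J₀ : SupportedOn J₀ w
      w⊆J₀ i i∉J₀ with i ∈? J
      ... | no i∉J = w⊆J i i∉J
      ... | yes i∈J = ≢0*≡0⇒≡0 (i∉J₀ ∘ Equivalence.from (proj₂ (u-on-J i i∈J)))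
                        (trans (QP.*-comm (u i) (w i)) (+-nonNeg-≡0ˡ (wu≥0 i) (zd≥0 i) (terms≡0 i)))
      z⊆K₀ : SupportedOn K₀ z
      z⊆K₀ i i∉K₀ with i ∈? K
      ... | no i∉K = z⊆K i i∉K
      ... | yes i∈K = ≢0*≡0⇒≡0 (i∉K₀ ∘ Equivalence.from (proj₂ (u-on-K i i∈K)))
                        (trans (QP.*-comm (d i) (z i)) (+-nonNeg-≡0ʳ (wu≥0 i) (zd≥0 i) (terms≡0 i)))

    supported⇒kernel : SupportedOn J₀ w → SupportedOn K₀ z → dot u x ≡ 0ℚ
    supported⇒kernel w⊆J₀ z⊆K₀ = trans dot≡terms (sum-≡0 (λ i →
        trans (cong₂ _+_ (≡0⊎≡0⇒*≡0 (wu-factor≡0 i)) (≡0⊎≡0⇒*≡0 (zd-factor≡0 i))) (QP.+-identityʳ 0ℚ)))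
      where
      wu-factor≡0 : ∀ i → w i ≡ 0ℚ ⊎ u i ≡ 0ℚ
      wu-factor≡0 i with i ∈? J₀ | i ∈? J
      ... | no i∉J₀ | _ = inj₁ (w⊆J₀ i i∉J₀)
      ... | yes _ | no i∉J = inj₁ (w⊆J i i∉J)
      ... | yes i∈J₀ | yes i∈J = inj₂ (Equivalence.to (proj₂ (u-on-J i i∈J)) i∈J₀)
      zd-factor≡0 : ∀ i → z i ≡ 0ℚ ⊎ d i ≡ 0ℚ
      zd-factor≡0 i with i ∈? K₀ | i ∈? K
      ... | no i∉K₀ | _ = inj₁ (z⊆K₀ i i∉K₀)
      ... | yes _ | no i∉K = inj₁ (z⊆K i i∉K)
      ... | yes i∈K₀ | yes i∈K = inj₂ (Equivalence.to (proj₂ (u-on-K i i∈K)) i∈K₀)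

  σ∩≐kernel : σ q (J ∩ J₀) (K ∩ K₀) ≐ (λ x → σ q J K x × dot u x ≡ 0ℚ)
  σ∩≐kernel x = mk⇔ to from
    where
    to : σ q (J ∩ J₀) (K ∩ K₀) x → σ q J K x × dot u x ≡ 0ℚ
    to s = representation⇒σ R , supported⇒kernel R (supported-∩⁻ʳ w⊆J∩J₀) (supported-∩⁻ʳ z⊆K∩K₀)
      where
      R₀ = σ⇒representation s
      open Representation R₀ renaming (w⊆J to w⊆J∩J₀; z⊆K to z⊆K∩K₀)
      R = withSupports R₀ (supported-∩⁻ˡ w⊆J∩J₀) (supported-∩⁻ˡ z⊆K∩K₀)
    from : σ q J K x × dot u x ≡ 0ℚ → σ q (J ∩ J₀) (K ∩ K₀) x
    from (s , dot≡0) = representation⇒σ (withSupports R (supported-∩⁺ w⊆J (proj₁ supported))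
                                                         (supported-∩⁺ z⊆K (proj₂ supported)))
      where
      R = σ⇒representation s
      open Representation R
      supported = kernel⇒supported R dot≡0

  isFace : IsFace (σ q J K) (σ q (J ∩ J₀) (K ∩ K₀))
  isFace = u , (λ x s → dot-nonNeg (σ⇒representation s)) , σ∩≐kernel

IsFace-resp-≐ : ∀ {n} {C τ τ′ : Cone n} → τ ≐ τ′ → IsFace C τ → IsFace C τ′
IsFace-resp-≐ τ≐τ′ (u , u≥0 , τ≐ker) =
  u , u≥0 , λ x → mk⇔ (Equivalence.to (τ≐ker x) ∘ Equivalence.from (τ≐τ′ x))
                      (Equivalence.to (τ≐τ′ x) ∘ Equivalence.from (τ≐ker x))

stronglyConvex-of-apex : ∀ {n} {C τ : Cone n} → IsFace C τ → (∀ x → τ x → x ≗V zeroV) → StronglyConvex C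
stronglyConvex-of-apex {C = C} (u , u≥0 , τ≐kernel) τ⊆0 x x∈C -x∈C =
  τ⊆0 x (Equivalence.from (τ≐kernel x) (x∈C , QP.≤-antisym ux≤0 (u≥0 x x∈C)))
  where
  ux≤0 : dot u x ≤ 0ℚ
  ux≤0 = subst (_≤ 0ℚ) (neg-involutive (dot u x))
           (QP.neg-antimono-≤ (subst (0ℚ ≤_) (dot-negV u x) (u≥0 (negV x) -x∈C)))

-- Functionals with prescribed values on the generators

-- A total reciprocal (0 ⁻¹ = 0); it is only applied to pivots ≥ 1.
_⁻¹ : ℚ → ℚ
p ⁻¹ with p QP.≟ 0ℚ
... | yes _ = 0ℚ
... | no p≢0 = (1/ p) {{Q.≢-nonZero p≢0}}

⁻¹-inverse-≥1 : ∀ {p} → 1ℚ ≤ p → p * p ⁻¹ ≡ 1ℚ × 0ℚ ≤ p ⁻¹ × p ⁻¹ ≤ 1ℚ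
⁻¹-inverse-≥1 {p} 1≤p with p QP.≟ 0ℚ
... | yes refl = ⊥-elim (QP.<-irrefl refl (QP.<-≤-trans (QP.positive⁻¹ 1ℚ) 1≤p))
... | no p≢0 = inverse , 0≤p⁻¹ , p⁻¹≤1
  where
  instance
    p-nonZero : NonZero p
    p-nonZero = Q.≢-nonZero p≢0
  inverse : p * 1/ p ≡ 1ℚ
  inverse = QP.*-inverseʳ p
  0≤p⁻¹ : 0ℚ ≤ 1/ p
  0≤p⁻¹ = QP.<⇒≤ (QP.positive⁻¹ _ {{QP.1/pos⇒pos p {{Q.positive (QP.<-≤-trans (QP.positive⁻¹ 1ℚ) 1≤p)}}}})
  p⁻¹≤1 : 1/ p ≤ 1ℚ
  p⁻¹≤1 = subst₂ _≤_ (QP.*-identityˡ (1/ p)) inverse (QP.*-monoʳ-≤-nonNeg (1/ p) {{Q.nonNegative 0≤p⁻¹}} 1≤p)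

-- Gaussian elimination for the tridiagonal system in v 1 … v N, with v 0 = v (suc N) = 0:
-- v m = a m at unconstrained positions m, and Aᵀseq q v (m ∸ 1) = c m at constrained ones.
-- Forward elimination gives v m = slope m * v (suc m) + intercept m with 0 ≤ slope m ≤ q, so
-- every pivot q + 1 − slope m is ≥ 1; back m f performs f steps of back substitution.
module TridiagonalSolver {q : ℚ} (0<q : 0ℚ < q) (N : ℕ) (constrained : ℕ → Bool) (a c : ℕ → ℚ) where

  pivot : ℚ → ℚ
  pivot s = q + 1ℚ - s

  pivot≥1 : ∀ {s} → s ≤ q → 1ℚ ≤ pivot s
  pivot≥1 {s} s≤q = subst₂ _≤_ (solve 1 (λ s → s :- s :+ con 1ℚ := con 1ℚ) refl s)
                               (solve 2 (λ q s → q :- s :+ con 1ℚ := q :+ con 1ℚ :- s) refl q s)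
                               (QP.+-monoˡ-≤ 1ℚ (QP.+-monoˡ-≤ (- s) s≤q))

  step : Bool → ℚ → ℚ → ℚ × ℚ → ℚ × ℚ
  step false aₘ cₘ (s , t) = 0ℚ , aₘ
  step true aₘ cₘ (s , t) = q * pivot s ⁻¹ , (t + cₘ) * pivot s ⁻¹

  sweep : ℕ → ℚ × ℚ
  sweep zero = 0ℚ , 0ℚ
  sweep (suc m) = step (constrained (suc m)) (a (suc m)) (c (suc m)) (sweep m)

  slope intercept : ℕ → ℚ
  slope m = proj₁ (sweep m)
  intercept m = proj₂ (sweep m)

  sweep-free : ∀ {m} → constrained (suc m) ≡ false → sweep (suc m) ≡ (0ℚ , a (suc m))
  sweep-free {m} free = cong (λ b → step b (a (suc m)) (c (suc m)) (sweep m)) free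

  sweep-constrained : ∀ {m} → constrained (suc m) ≡ true →
    sweep (suc m) ≡ (q * pivot (slope m) ⁻¹ , (intercept m + c (suc m)) * pivot (slope m) ⁻¹)
  sweep-constrained {m} is-constrained = cong (λ b → step b (a (suc m)) (c (suc m)) (sweep m)) is-constrained

  slope-bounded : ∀ m → 0ℚ ≤ slope m × slope m ≤ q
  slope-bounded zero = QP.≤-refl , QP.<⇒≤ 0<q
  slope-bounded (suc m) with constrained (suc m)
  ... | false = QP.≤-refl , QP.<⇒≤ 0<q
  ... | true = *-nonNeg (QP.<⇒≤ 0<q) 0≤p⁻¹ ,
               subst (q * pivot (slope m) ⁻¹ ≤_) (QP.*-identityʳ q)
                     (QP.*-monoˡ-≤-nonNeg q {{Q.nonNegative (QP.<⇒≤ 0<q)}} p⁻¹≤1)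
    where
    0≤p⁻¹ = proj₁ (proj₂ (⁻¹-inverse-≥1 (pivot≥1 (proj₂ (slope-bounded m)))))
    p⁻¹≤1 = proj₂ (proj₂ (⁻¹-inverse-≥1 (pivot≥1 (proj₂ (slope-bounded m)))))

  back : ℕ → ℕ → ℚ
  back m zero = 0ℚ
  back m (suc fuel) = slope m * back (suc m) fuel + intercept m

  v : ℕ → ℚ
  v m = back m (suc N ∸ m)

  v-step : ∀ {m} → m ℕ.≤ N → v m ≡ slope m * v (suc m) + intercept m
  v-step m≤N rewrite ℕP.+-∸-assoc 1 m≤N = refl

  v-end : v (suc N) ≡ 0ℚ
  v-end rewrite ℕP.n∸n≡0 N = refl

  v-start : v 0 ≡ 0ℚ
  v-start = trans (v-step ℕ.z≤n) (solve 1 (λ x → con 0ℚ :* x :+ con 0ℚ := con 0ℚ) refl (v 1))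

  v-free : ∀ {m} → suc m ℕ.≤ N → constrained (suc m) ≡ false → v (suc m) ≡ a (suc m)
  v-free {m} m<N free = begin
    v (suc m)                               ≡⟨ v-step m<N ⟩
    slope (suc m) * v₂ + intercept (suc m)  ≡⟨ cong (λ (s , t) → s * v₂ + t) (sweep-free free) ⟩
    0ℚ * v₂ + a (suc m)                     ≡⟨ solve 2 (λ x y → con 0ℚ :* x :+ y := y) refl v₂ (a (suc m)) ⟩
    a (suc m)                               ∎
    where
    open ≡-Reasoning
    v₂ = v (suc (suc m))

  v-constrained : ∀ {m} → suc m ℕ.≤ N → constrained (suc m) ≡ true → Aᵀseq q v m ≡ c (suc m)
  v-constrained {m} m<N is-constrained = begin
    (q + 1ℚ) * v₁ - v m - q * v₂
      ≡⟨ cong (λ x → (q + 1ℚ) * v₁ - x - q * v₂) (v-step (ℕP.<⇒≤ m<N)) ⟩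
    (q + 1ℚ) * v₁ - (s * v₁ + t) - q * v₂
      ≡⟨ solve 5 (λ q s t v₁ v₂ → (q :+ con 1ℚ) :* v₁ :- (s :* v₁ :+ t) :- q :* v₂
                                 := (q :+ con 1ℚ :- s) :* v₁ :- (q :* v₂ :+ t)) refl q s t v₁ v₂ ⟩
    pivot s * v₁ - (q * v₂ + t)
      ≡⟨ cong (λ x → pivot s * x - (q * v₂ + t)) v₁≡ ⟩
    pivot s * ((q * v₂ + t + cₘ) * pivot s ⁻¹) - (q * v₂ + t)
      ≡⟨ solve 5 (λ p r y t c → p :* ((y :+ t :+ c) :* r) :- (y :+ t) := (p :* r) :* (y :+ t :+ c) :- (y :+ t))
                 refl (pivot s) (pivot s ⁻¹) (q * v₂) t cₘ ⟩
    (pivot s * pivot s ⁻¹) * (q * v₂ + t + cₘ) - (q * v₂ + t)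
      ≡⟨ cong (λ x → x * (q * v₂ + t + cₘ) - (q * v₂ + t)) pivot-inverse ⟩
    1ℚ * (q * v₂ + t + cₘ) - (q * v₂ + t)
      ≡⟨ solve 2 (λ y c → con 1ℚ :* (y :+ c) :- y := c) refl (q * v₂ + t) cₘ ⟩
    cₘ ∎
    where
    open ≡-Reasoning
    s = slope m
    t = intercept m
    cₘ = c (suc m)
    v₁ = v (suc m)
    v₂ = v (suc (suc m))
    pivot-inverse : pivot s * pivot s ⁻¹ ≡ 1ℚ
    pivot-inverse = proj₁ (⁻¹-inverse-≥1 (pivot≥1 (proj₂ (slope-bounded m))))
    v₁≡ : v₁ ≡ (q * v₂ + t + cₘ) * pivot s ⁻¹
    v₁≡ = begin
      v₁                                           ≡⟨ v-step m<N ⟩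
      slope (suc m) * v₂ + intercept (suc m)       ≡⟨ cong (λ (s′ , t′) → s′ * v₂ + t′) (sweep-constrained is-constrained) ⟩
      q * pivot s ⁻¹ * v₂ + (t + cₘ) * pivot s ⁻¹
        ≡⟨ solve 5 (λ q r v t c → q :* r :* v :+ (t :+ c) :* r := (q :* v :+ t :+ c) :* r) refl q (pivot s ⁻¹) v₂ t cₘ ⟩
      (q * v₂ + t + cₘ) * pivot s ⁻¹               ∎

Aᵀseq-cong : ∀ q {U V : ℕ → ℚ} m → U m ≡ V m → U (suc m) ≡ V (suc m) → U (suc (suc m)) ≡ V (suc (suc m)) →
             Aᵀseq q U m ≡ Aᵀseq q V m
Aᵀseq-cong q m p₀ p₁ p₂ = cong₂ _-_ (cong₂ _-_ (cong ((q + 1ℚ) *_) p₁) p₀) (cong (q *_) p₂)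

prescribedFunctional : ∀ {n} {q} → 0ℚ < q → (K : Subset n) (a c : Vec n) →
  Σ (Vec n) λ u → (∀ i → i ∉ K → u i ≡ a i) × (∀ k → k ∈ K → dot u (α q k) ≡ c k)
prescribedFunctional {n} {q} 0<q K a c = u , u-free , u-constrained
  where
  open TridiagonalSolver 0<q n (padWith false (λ i → does (i ∈? K))) (pad a) (pad c)
  u : Vec n
  u i = v (suc (toℕ i))
  pad-u : ∀ m → m ℕ.≤ suc n → pad u m ≡ v m
  pad-u zero _ = trans (padWith-zero 0ℚ u) (sym v-start)
  pad-u (suc m) m<1+n with ℕP.m≤n⇒m<n∨m≡n (ℕ.s≤s⁻¹ m<1+n)
  ... | inj₁ m<n = begin
    pad u (suc m)                           ≡⟨ cong (pad u ∘ suc) (FP.toℕ-fromℕ< m<n) ⟨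
    pad u (suc (toℕ (F.fromℕ< m<n)))        ≡⟨ padWith-toℕ 0ℚ u (F.fromℕ< m<n) ⟩
    v (suc (toℕ (F.fromℕ< m<n)))            ≡⟨ cong (v ∘ suc) (FP.toℕ-fromℕ< m<n) ⟩
    v (suc m)                               ∎
    where open ≡-Reasoning
  ... | inj₂ refl = trans (padWith-suc-n 0ℚ u) (sym v-end)
  u-free : ∀ i → i ∉ K → u i ≡ a i
  u-free i i∉K = trans (v-free (FP.toℕ<n i) (trans (padWith-toℕ false _ i) (dec-false (i ∈? K) i∉K)))
                       (padWith-toℕ 0ℚ a i)
  u-constrained : ∀ k → k ∈ K → dot u (α q k) ≡ c k
  u-constrained k k∈K = begin
    dot u (α q k)             ≡⟨ dot-α≡Aᵀseq q u k ⟩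
    Aᵀseq q (pad u) (toℕ k)   ≡⟨ Aᵀseq-cong q {pad u} {v} (toℕ k) (pad-u _ (ℕP.m≤n⇒m≤1+n (ℕP.<⇒≤ k<n)))
                                                     (pad-u _ (ℕP.m≤n⇒m≤1+n k<n)) (pad-u _ (ℕ.s≤s k<n)) ⟩
    Aᵀseq q v (toℕ k)         ≡⟨ v-constrained k<n (trans (padWith-toℕ false _ k) (dec-true (k ∈? K) k∈K)) ⟩
    pad c (suc (toℕ k))       ≡⟨ padWith-toℕ 0ℚ c k ⟩
    c k                       ∎
    where
    open ≡-Reasoning
    k<n = FP.toℕ<n k

-- The fan

indicator∁ : ∀ {n} → Subset n → Vec n
indicator∁ S i = if does (i ∈? S) then 0ℚ else 1ℚ

indicator∁-nonNeg : ∀ {n} (S : Subset n) i → 0ℚ ≤ indicator∁ S i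
indicator∁-nonNeg S i with i ∈? S
... | yes _ = QP.≤-refl
... | no _ = QP.<⇒≤ (QP.positive⁻¹ 1ℚ)

indicator∁≡0⇔∈ : ∀ {n} (S : Subset n) i → i ∈ S ⇔ indicator∁ S i ≡ 0ℚ
indicator∁≡0⇔∈ S i with i ∈? S
... | yes i∈S = mk⇔ (λ _ → refl) (λ _ → i∈S)
... | no i∉S = mk⇔ (⊥-elim ∘ i∉S) (⊥-elim ∘ QP.1≢0)

σ-isFace-∩ : ∀ {n} {q} {J K : Subset n} → 0ℚ < q → Disjoint J K → (J₀ K₀ : Subset n) →
  IsFace (σ q J K) (σ q (J ∩ J₀) (K ∩ K₀))
σ-isFace-∩ {n} {q} {J} {K} 0<q J∩K≡∅ J₀ K₀ =
  faceOf (prescribedFunctional 0<q K (indicator∁ J₀) (λ k → - indicator∁ K₀ k))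
  where
  faceOf : Σ (Vec n) (λ u → (∀ i → i ∉ K → u i ≡ indicator∁ J₀ i) ×
                            (∀ k → k ∈ K → dot u (α q k) ≡ - indicator∁ K₀ k)) →
           IsFace (σ q J K) (σ q (J ∩ J₀) (K ∩ K₀))
  faceOf (u , u-free , u-constrained) = Face.isFace q u J K J₀ K₀ u-on-J u-on-K
    where
    u-on-J : ∀ i → i ∈ J → 0ℚ ≤ u i × (i ∈ J₀ ⇔ u i ≡ 0ℚ)
    u-on-J i i∈J = subst (λ t → 0ℚ ≤ t × (i ∈ J₀ ⇔ t ≡ 0ℚ)) (sym (u-free i (J∩K≡∅ i i∈J)))
                         (indicator∁-nonNeg J₀ i , indicator∁≡0⇔∈ J₀ i)
    u-on-K : ∀ k → k ∈ K → 0ℚ ≤ dot u (negV (α q k)) × (k ∈ K₀ ⇔ dot u (negV (α q k)) ≡ 0ℚ)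
    u-on-K k k∈K = subst (λ t → 0ℚ ≤ t × (k ∈ K₀ ⇔ t ≡ 0ℚ)) (sym d≡χ)
                         (indicator∁-nonNeg K₀ k , indicator∁≡0⇔∈ K₀ k)
      where
      d≡χ : dot u (negV (α q k)) ≡ indicator∁ K₀ k
      d≡χ = trans (dot-negV u (α q k)) (trans (cong -_ (u-constrained k k∈K)) (neg-involutive (indicator∁ K₀ k)))

σ-∩≐σ×σ : ∀ {n} {q} {J K J′ K′ : Subset n} → 0ℚ < q → Disjoint J K → Disjoint J′ K′ →
  σ q (J ∩ J′) (K ∩ K′) ≐ (λ x → σ q J K x × σ q J′ K′ x)
σ-∩≐σ×σ {q = q} {J} {K} {J′} {K′} 0<q J∩K≡∅ J′∩K′≡∅ x = mk⇔ to from
  where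
  to : σ q (J ∩ J′) (K ∩ K′) x → σ q J K x × σ q J′ K′ x
  to s = representation⇒σ (withSupports R (supported-∩⁻ˡ w⊆J) (supported-∩⁻ˡ z⊆K))
       , representation⇒σ (withSupports R (supported-∩⁻ʳ w⊆J) (supported-∩⁻ʳ z⊆K))
    where
    R : Representation q (J ∩ J′) (K ∩ K′) x
    R = σ⇒representation s
    open Representation R
  from : σ q J K x × σ q J′ K′ x → σ q (J ∩ J′) (K ∩ K′) x
  from (s , s′) = representation⇒σ (withSupports R
      (supported-∩⁺ (Representation.w⊆J R) (λ i i∉J′ → trans (proj₁ same i) (Representation.w⊆J R′ i i∉J′)))
      (supported-∩⁺ (Representation.z⊆K R) (λ i i∉K′ → trans (proj₂ same i) (Representation.z⊆K R′ i i∉K′))))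
    where
    R : Representation q J K x
    R = σ⇒representation s
    R′ : Representation q J′ K′ x
    R′ = σ⇒representation s′
    same = representation-unique R R′ 0<q J∩K≡∅ J′∩K′≡∅

σ-intersectFace : ∀ {n} {q} {J K J′ K′ : Subset n} → 0ℚ < q → Disjoint J K → Disjoint J′ K′ →
  IsFace (σ q J K) (λ x → σ q J K x × σ q J′ K′ x)
σ-intersectFace 0<q J∩K≡∅ J′∩K′≡∅ =
  IsFace-resp-≐ (σ-∩≐σ×σ 0<q J∩K≡∅ J′∩K′≡∅) (σ-isFace-∩ 0<q J∩K≡∅ _ _)

subsetOf : ∀ {n} {P : Fin n → Set} → (∀ i → Dec (P i)) → Subset n
subsetOf {zero} P? = []
subsetOf {suc n} P? = does (P? F.zero) ∷ subsetOf (P? ∘ F.suc)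

∈-subsetOf⁺ : ∀ {n} {P : Fin n → Set} (P? : ∀ i → Dec (P i)) {i} → P i → i ∈ subsetOf P?
∈-subsetOf⁺ P? {F.zero} Pi with P? F.zero
... | yes _ = here
... | no ¬Pi = ⊥-elim (¬Pi Pi)
∈-subsetOf⁺ P? {F.suc i} Pi = there (∈-subsetOf⁺ (P? ∘ F.suc) Pi)

∈-subsetOf⁻ : ∀ {n} {P : Fin n → Set} (P? : ∀ i → Dec (P i)) {i} → i ∈ subsetOf P? → P i
∈-subsetOf⁻ P? {F.zero} i∈P with P? F.zero
... | yes Pi = Pi
∈-subsetOf⁻ P? {F.zero} () | no _
∈-subsetOf⁻ P? {F.suc i} (there i∈P) = ∈-subsetOf⁻ (P? ∘ F.suc) i∈P

∈-subsetOf⇔ : ∀ {n} {P : Fin n → Set} (P? : ∀ i → Dec (P i)) i → i ∈ subsetOf P? ⇔ P i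
∈-subsetOf⇔ P? i = mk⇔ (∈-subsetOf⁻ P?) (∈-subsetOf⁺ P?)

e∈σ : ∀ {n} {q} {J K : Subset n} {i} → i ∈ J → σ q J K (e i)
e∈σ {q = q} {J} {i = i} i∈J = representation⇒σ (representation (e i) zeroV (e-nonNeg i) (λ _ → QP.≤-refl)
  (λ l l∉J → e-off-diagonal (λ l≡i → l∉J (subst (_∈ J) (sym l≡i) i∈J))) (λ _ _ → refl)
  (λ l → sym (trans (cong (λ t → e i l - t) (A-zero q l)) (QP.+-identityʳ (e i l)))))

negα∈σ : ∀ {n} {q} {J K : Subset n} {k} → k ∈ K → σ q J K (negV (α q k))
negα∈σ {q = q} {K = K} {k} k∈K = representation⇒σ (representation zeroV (e k) (λ _ → QP.≤-refl) (e-nonNeg k)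
  (λ _ _ → refl) (λ l l∉K → e-off-diagonal (λ l≡k → l∉K (subst (_∈ K) (sym l≡k) k∈K)))
  (λ l → sym (trans (cong (λ t → 0ℚ - t) (sum-e* (λ m → α q m l) k)) (QP.+-identityˡ (- α q k l)))))

σ-faceClosed : ∀ {n} {q} {J K : Subset n} → Disjoint J K →
  (τ : Cone n) → IsFace (σ q J K) τ → Σ (Idx n) λ j → τ ≐ Σnq n q j
σ-faceClosed {n} {q} {J} {K} J∩K≡∅ τ (u , u≥0 , τ≐kernel) =
  ((J ∩ J₀ , K ∩ K₀) , J∩J₀∩K∩K₀≡∅) ,
  λ x → mk⇔ (Equivalence.from (σ∩≐kernel x) ∘ Equivalence.to (τ≐kernel x))
            (Equivalence.from (τ≐kernel x) ∘ Equivalence.to (σ∩≐kernel x))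
  where
  d : Fin n → ℚ
  d k = dot u (negV (α q k))
  J₀ K₀ : Subset n
  J₀ = subsetOf (λ i → u i QP.≟ 0ℚ)
  K₀ = subsetOf (λ k → d k QP.≟ 0ℚ)
  J∩J₀∩K∩K₀≡∅ : Disjoint (J ∩ J₀) (K ∩ K₀)
  J∩J₀∩K∩K₀≡∅ i i∈J∩J₀ i∈K∩K₀ =
    J∩K≡∅ i (proj₁ (x∈p∩q⁻ J J₀ i∈J∩J₀)) (proj₁ (x∈p∩q⁻ K K₀ i∈K∩K₀))
  open Face q u J K J₀ K₀
    (λ i i∈J → subst (0ℚ ≤_) (dot-e u i) (u≥0 (e i) (e∈σ i∈J)) , ∈-subsetOf⇔ (λ i → u i QP.≟ 0ℚ) i)
    (λ k k∈K → u≥0 (negV (α q k)) (negα∈σ k∈K) , ∈-subsetOf⇔ (λ k → d k QP.≟ 0ℚ) k)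
    using (σ∩≐kernel)

σ-apex : ∀ {n} {q} {J K : Subset n} x → σ q (J ∩ ⊥) (K ∩ ⊥) x → x ≗V zeroV
σ-apex {q = q} {J} {K} x s i = begin
  x i             ≡⟨ x≡w-Az i ⟩
  w i - A q z i   ≡⟨ cong₂ _-_ (w⊆J i (∉⊥ ∘ proj₂ ∘ x∈p∩q⁻ J ⊥))
                               (trans (A-cong q (λ k → z⊆K k (∉⊥ ∘ proj₂ ∘ x∈p∩q⁻ K ⊥)) i) (A-zero q i)) ⟩
  0ℚ - 0ℚ         ≡⟨⟩
  0ℚ              ∎
  where
  open ≡-Reasoning
  R : Representation q (J ∩ ⊥) (K ∩ ⊥) x
  R = σ⇒representation s
  open Representation R

σ-stronglyConvex : ∀ {n} {q} {J K : Subset n} → 0ℚ < q → Disjoint J K → StronglyConvex (σ q J K)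
σ-stronglyConvex 0<q J∩K≡∅ = stronglyConvex-of-apex (σ-isFace-∩ 0<q J∩K≡∅ ⊥ ⊥) σ-apex

corollary3p3 : (n : ℕ) → 1 ℕ.≤ n → (q : ℚ) → 0ℚ < q → IsSimplicialFan (Idx n) (Σnq n q)
corollary3p3 n _ q 0<q = record
  { isFan = record
    { polyhedral = λ { ((J , K) , _) → gens q J K , λ x → mk⇔ id id }
    ; stronglyConvex = λ { ((J , K) , J∩K≡∅) → σ-stronglyConvex 0<q J∩K≡∅ }
    ; faceClosed = λ { ((J , K) , J∩K≡∅) → σ-faceClosed J∩K≡∅ }
    ; intersectFace = λ { ((J , K) , J∩K≡∅) ((J′ , K′) , J′∩K′≡∅) →
        σ-intersectFace 0<q J∩K≡∅ J′∩K′≡∅ ,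
        IsFace-resp-≐ (λ x → mk⇔ swap swap) (σ-intersectFace 0<q J′∩K′≡∅ J∩K≡∅) }
    }
  ; simplicial = λ { ((J , K) , J∩K≡∅) →
      gens q J K , Generators.gens-linIndep q J K 0<q J∩K≡∅ , λ x → mk⇔ id id }
  }
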